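{- Let $\sigma = \exists x\,\sigma_0(x)$ be a pure 1-$\Sigma_1$-sentence and let $\sigma^{\mathsf{cert}} := \exists x\,(\mathsf{cert}(x) \wedge \sigma_0(x))$. Then: (1) $\sigma^{\mathsf{cert}} \vdash \sigma$; (2) if $\mathbb{N} \models \sigma$, then $\mathsf{R}_0 \vdash \sigma^{\mathsf{cert}}$; (3) if $\mathbb{N} \models \neg\sigma$, then $\sigma^{\mathsf{cert}} \vdash \mathsf{R}_0$.
   Context: $\mathbb{L}_{\sf a}$ is the signature $\{0, \mathsf{S}, +, \times, \leq\}$ with $\leq$ primitive; $\overline{n}$ is the $n$-th numeral. $\mathsf{R}_0$ is the $\mathbb{L}_{\sf a}$-theory with axioms, for all $m,n\in\omega$: $\overline{m}+\overline{n} = \overline{m+n}$; $\overline{m}\times\overline{n} = \overline{m\times n}$; $\overline{m}\neq\overline{n}$ if $m\neq n$; $\forall x\,(x\leq\overline{n}\to\bigvee_{i\leq n}x=\overline{i})$; $\overline{m}\leq\overline{n}$ if $m\leq n$. $x<y$ abbreviates $x\leq y\wedge x\neq y$. A pure $\Delta_0$-formula is a bounded-quantifier formula in which every atomic $t_1\leq t_2$ has $t_1,t_2$ variables and every atomic $t_1=t_2$ is of one of the forms $x_0=x_1$, $0=x_0$, $\mathsf{S}x_0=x_1$, $x_0+x_1=x_2$, $x_0\times x_1=x_2$ ($x_i$ variables). A pure 1-$\Sigma_1$-sentence is $\exists x\,\sigma_0(x)$ with $\sigma_0$ pure $\Delta_0$. $\mathsf{cert}(v)$ is the conjunction of: A1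 $0\leq v$; A2 $\forall x<v\;\mathsf{S}x\leq v$; A3 $\forall x\,(x\leq 0\leftrightarrow x=0)$; A4 $\forall x<v\,\forall y\,(y\leq\mathsf{S}x\leftrightarrow(y\leq x\vee y=\mathsf{S}x))$; A5 $\forall x,y,z\leq v\;\mathsf{S}((x\times y)+z)\neq 0$; A6 $\forall x,y,z,w\leq v\;(\mathsf{S}((x\times y)+z)=\mathsf{S}w\to(x\times y)+z=w)$; A7 $\forall x,y\leq v\;(x\times y)+0=x\times y$; A8 $\forall x,y,z\leq v\;(x\times y)+\mathsf{S}z=\mathsf{S}((x\times y)+z)$; A9 $\forall x\leq v\;x\times 0=0$; A10 $\forall x,y\leq v\;x\times\mathsf{S}y=(x\times y)+x$. -}

module Defs where

open import Data.Nat using (ℕ; zero; suc; _+_; _*_; _≤_)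
open import Data.Fin using (Fin; zero; suc; #_)
open import Data.Product using (Σ; _×_; _,_)
open import Data.Sum using (_⊎_)
open import Data.Empty using (⊥)
open import Relation.Nullary using (¬_)
open import Relation.Nullary.Decidable using (True)
open import Data.Nat using (_<?_)
open import Relation.Binary.PropositionalEquality using (_≡_; _≢_)

-- Syntax of the language L_a = {0, S, +, ×, ≤}, well-scoped de Bruijn:
-- Term n / Formula n have free variables among Fin n (var zero = the
-- innermost bound variable).

infixl 7 _`×_
infixl 6 _`+_
infix  4 _≐_ _≼_
infixr 3 _`∧_
infixr 2 _`∨_
infixr 1 _⇒_ _⇔_
infix  5 `¬_
infixl 0 _,,_
infix  4 _≺_

data Term (n : ℕ) : Set where
  var   : Fin n → Term n
  `0    : Term n
  `S    : Term n → Term n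
  _`+_  : Term n → Term n → Term n
  _`×_  : Term n → Term n → Term n

data Formula (n : ℕ) : Set where
  `⊥   : Formula n
  _≐_  : Term n → Term n → Formula n
  _≼_  : Term n → Term n → Formula n
  `¬_  : Formula n → Formula n
  _`∧_ : Formula n → Formula n → Formula n
  _`∨_ : Formula n → Formula n → Formula n
  _⇒_  : Formula n → Formula n → Formula n
  `∀   : Formula (suc n) → Formula n
  `∃   : Formula (suc n) → Formula n

_⇔_ : ∀ {n} → Formula n → Formula n → Formula n
φ ⇔ ψ = (φ ⇒ ψ) `∧ (ψ ⇒ φ)

Sentence : Set
Sentence = Formula 0

lift : ∀ {n m} → (Fin n → Fin m) → Fin (suc n) → Fin (suc m)
lift ρ zero    = zero
lift ρ (suc i) = suc (ρ i)

tren : ∀ {n m} → (Fin n → Fin m) → Term n → Term m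
tren ρ (var i)  = var (ρ i)
tren ρ `0       = `0
tren ρ (`S t)   = `S (tren ρ t)
tren ρ (s `+ t) = tren ρ s `+ tren ρ t
tren ρ (s `× t) = tren ρ s `× tren ρ t

fren : ∀ {n m} → (Fin n → Fin m) → Formula n → Formula m
fren ρ `⊥        = `⊥
fren ρ (s ≐ t)   = tren ρ s ≐ tren ρ t
fren ρ (s ≼ t)   = tren ρ s ≼ tren ρ t
fren ρ (`¬ φ)    = `¬ fren ρ φ
fren ρ (φ `∧ ψ)  = fren ρ φ `∧ fren ρ ψ
fren ρ (φ `∨ ψ)  = fren ρ φ `∨ fren ρ ψ
fren ρ (φ ⇒ ψ)   = fren ρ φ ⇒ fren ρ ψ
fren ρ (`∀ φ)    = `∀ (fren (lift ρ) φ)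
fren ρ (`∃ φ)    = `∃ (fren (lift ρ) φ)

wkT : ∀ {n} → Term n → Term (suc n)
wkT = tren suc

wkF : ∀ {n} → Formula n → Formula (suc n)
wkF = fren suc

exts : ∀ {n m} → (Fin n → Term m) → Fin (suc n) → Term (suc m)
exts σ zero    = var zero
exts σ (suc i) = wkT (σ i)

tsub : ∀ {n m} → (Fin n → Term m) → Term n → Term m
tsub σ (var i)  = σ i
tsub σ `0       = `0
tsub σ (`S t)   = `S (tsub σ t)
tsub σ (s `+ t) = tsub σ s `+ tsub σ t
tsub σ (s `× t) = tsub σ s `× tsub σ t

fsub : ∀ {n m} → (Fin n → Term m) → Formula n → Formula m
fsub σ `⊥        = `⊥
fsub σ (s ≐ t)   = tsub σ s ≐ tsub σ t
fsub σ (s ≼ t)   = tsub σ s ≼ tsub σ t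
fsub σ (`¬ φ)    = `¬ fsub σ φ
fsub σ (φ `∧ ψ)  = fsub σ φ `∧ fsub σ ψ
fsub σ (φ `∨ ψ)  = fsub σ φ `∨ fsub σ ψ
fsub σ (φ ⇒ ψ)   = fsub σ φ ⇒ fsub σ ψ
fsub σ (`∀ φ)    = `∀ (fsub (exts σ) φ)
fsub σ (`∃ φ)    = `∃ (fsub (exts σ) φ)

sub0 : ∀ {n} → Term n → Fin (suc n) → Term n
sub0 t zero    = t
sub0 t (suc i) = var i

_[_] : ∀ {n} → Formula (suc n) → Term n → Formula n
φ [ t ] = fsub (sub0 t) φ

-- Classical first-order natural deduction with equality.
-- A context/theory is a (possibly infinite) predicate on formulas.

Ctx : ℕ → Set₁
Ctx n = Formula n → Set

_,,_ : ∀ {n} → Ctx n → Formula n → Ctx n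
(Γ ,, φ) ψ = Γ ψ ⊎ ψ ≡ φ

↑_ : ∀ {n} → Ctx n → Ctx (suc n)
(↑ Γ) ψ = Σ (Formula _) λ χ → Γ χ × ψ ≡ wkF χ

infix 0 _⊢_

data _⊢_ : ∀ {n} → Ctx n → Formula n → Set₁ where
  hyp  : ∀ {n} {Γ : Ctx n} {φ} → Γ φ → Γ ⊢ φ
  ⊥E   : ∀ {n} {Γ : Ctx n} {φ} → Γ ⊢ `⊥ → Γ ⊢ φ
  ¬I   : ∀ {n} {Γ : Ctx n} {φ} → (Γ ,, φ) ⊢ `⊥ → Γ ⊢ `¬ φ
  ¬E   : ∀ {n} {Γ : Ctx n} {φ} → Γ ⊢ `¬ φ → Γ ⊢ φ → Γ ⊢ `⊥
  raa  : ∀ {n} {Γ : Ctx n} {φ} → (Γ ,, `¬ φ) ⊢ `⊥ → Γ ⊢ φ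
  ∧I   : ∀ {n} {Γ : Ctx n} {φ ψ} → Γ ⊢ φ → Γ ⊢ ψ → Γ ⊢ φ `∧ ψ
  ∧E₁  : ∀ {n} {Γ : Ctx n} {φ ψ} → Γ ⊢ φ `∧ ψ → Γ ⊢ φ
  ∧E₂  : ∀ {n} {Γ : Ctx n} {φ ψ} → Γ ⊢ φ `∧ ψ → Γ ⊢ ψ
  ∨I₁  : ∀ {n} {Γ : Ctx n} {φ ψ} → Γ ⊢ φ → Γ ⊢ φ `∨ ψ
  ∨I₂  : ∀ {n} {Γ : Ctx n} {φ ψ} → Γ ⊢ ψ → Γ ⊢ φ `∨ ψ
  ∨E   : ∀ {n} {Γ : Ctx n} {φ ψ χ} → Γ ⊢ φ `∨ ψ →
         (Γ ,, φ) ⊢ χ → (Γ ,, ψ) ⊢ χ → Γ ⊢ χ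
  ⇒I   : ∀ {n} {Γ : Ctx n} {φ ψ} → (Γ ,, φ) ⊢ ψ → Γ ⊢ φ ⇒ ψ
  ⇒E   : ∀ {n} {Γ : Ctx n} {φ ψ} → Γ ⊢ φ ⇒ ψ → Γ ⊢ φ → Γ ⊢ ψ
  ∀I   : ∀ {n} {Γ : Ctx n} {φ} → ↑ Γ ⊢ φ → Γ ⊢ `∀ φ
  ∀E   : ∀ {n} {Γ : Ctx n} {φ} (t : Term n) → Γ ⊢ `∀ φ → Γ ⊢ φ [ t ]
  ∃I   : ∀ {n} {Γ : Ctx n} {φ} (t : Term n) → Γ ⊢ φ [ t ] → Γ ⊢ `∃ φ
  ∃E   : ∀ {n} {Γ : Ctx n} {φ ψ} → Γ ⊢ `∃ φ → (↑ Γ ,, φ) ⊢ wkF ψ → Γ ⊢ ψ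
  ≐refl : ∀ {n} {Γ : Ctx n} (t : Term n) → Γ ⊢ t ≐ t
  ≐subst : ∀ {n} {Γ : Ctx n} {s t : Term n} (φ : Formula (suc n)) →
           Γ ⊢ s ≐ t → Γ ⊢ φ [ s ] → Γ ⊢ φ [ t ]

_⊢ᵀ_ : Ctx 0 → Ctx 0 → Set₁
T ⊢ᵀ U = ∀ φ → U φ → T ⊢ φ

⟨_⟩ : Sentence → Ctx 0
⟨ χ ⟩ ψ = ψ ≡ χ

_∷ᵉ_ : ∀ {n} → ℕ → (Fin n → ℕ) → Fin (suc n) → ℕ
(a ∷ᵉ ρ) zero    = a
(a ∷ᵉ ρ) (suc i) = ρ i

⟦_⟧t : ∀ {n} → Term n → (Fin n → ℕ) → ℕ
⟦ var i ⟧t ρ  = ρ i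
⟦ `0 ⟧t ρ     = 0
⟦ `S t ⟧t ρ   = suc (⟦ t ⟧t ρ)
⟦ s `+ t ⟧t ρ = ⟦ s ⟧t ρ + ⟦ t ⟧t ρ
⟦ s `× t ⟧t ρ = ⟦ s ⟧t ρ * ⟦ t ⟧t ρ

⟦_⟧ : ∀ {n} → Formula n → (Fin n → ℕ) → Set
⟦ `⊥ ⟧ ρ     = ⊥
⟦ s ≐ t ⟧ ρ  = ⟦ s ⟧t ρ ≡ ⟦ t ⟧t ρ
⟦ s ≼ t ⟧ ρ  = ⟦ s ⟧t ρ ≤ ⟦ t ⟧t ρ
⟦ `¬ φ ⟧ ρ   = ¬ ⟦ φ ⟧ ρ
⟦ φ `∧ ψ ⟧ ρ = ⟦ φ ⟧ ρ × ⟦ ψ ⟧ ρ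
⟦ φ `∨ ψ ⟧ ρ = ⟦ φ ⟧ ρ ⊎ ⟦ ψ ⟧ ρ
⟦ φ ⇒ ψ ⟧ ρ  = ⟦ φ ⟧ ρ → ⟦ ψ ⟧ ρ
⟦ `∀ φ ⟧ ρ   = (a : ℕ) → ⟦ φ ⟧ (a ∷ᵉ ρ)
⟦ `∃ φ ⟧ ρ   = Σ ℕ λ a → ⟦ φ ⟧ (a ∷ᵉ ρ)

ℕ⊨_ : Sentence → Set
ℕ⊨ σ = ⟦ σ ⟧ (λ ())

num : ∀ {n} → ℕ → Term n
num zero    = `0
num (suc k) = `S (num k)

bigOr : ∀ {n} → Term n → ℕ → Formula n
bigOr t zero    = t ≐ num 0
bigOr t (suc k) = bigOr t k `∨ (t ≐ num (suc k))

data R₀ : Sentence → Set where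
  ax+  : ∀ m n → R₀ (num m `+ num n ≐ num (m + n))
  ax×  : ∀ m n → R₀ (num m `× num n ≐ num (m * n))
  ax≠  : ∀ m n → m ≢ n → R₀ (`¬ (num m ≐ num n))
  ax≤  : ∀ n → R₀ (`∀ (var zero ≼ num n ⇒ bigOr (var zero) n))
  ax≤' : ∀ m n → m ≤ n → R₀ (num m ≼ num n)

-- Pure Δ₀-formulas (atomic formulas and quantifier bounds are variables)

data PureΔ₀ (n : ℕ) : Set where
  eqv   : Fin n → Fin n → PureΔ₀ n
  zeq   : Fin n → PureΔ₀ n
  seq   : Fin n → Fin n → PureΔ₀ n
  addeq : Fin n → Fin n → Fin n → PureΔ₀ n
  muleq : Fin n → Fin n → Fin n → PureΔ₀ n
  lev   : Fin n → Fin n → PureΔ₀ n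
  neg   : PureΔ₀ n → PureΔ₀ n
  and   : PureΔ₀ n → PureΔ₀ n → PureΔ₀ n
  or    : PureΔ₀ n → PureΔ₀ n → PureΔ₀ n
  imp   : PureΔ₀ n → PureΔ₀ n → PureΔ₀ n
  ball  : Fin n → PureΔ₀ (suc n) → PureΔ₀ n
  bex   : Fin n → PureΔ₀ (suc n) → PureΔ₀ n

⌜_⌝ : ∀ {n} → PureΔ₀ n → Formula n
⌜ eqv x y ⌝     = var x ≐ var y
⌜ zeq x ⌝       = `0 ≐ var x
⌜ seq x y ⌝     = `S (var x) ≐ var y
⌜ addeq x y z ⌝ = var x `+ var y ≐ var z
⌜ muleq x y z ⌝ = var x `× var y ≐ var z
⌜ lev x y ⌝     = var x ≼ var y
⌜ neg φ ⌝       = `¬ ⌜ φ ⌝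
⌜ and φ ψ ⌝     = ⌜ φ ⌝ `∧ ⌜ ψ ⌝
⌜ or φ ψ ⌝      = ⌜ φ ⌝ `∨ ⌜ ψ ⌝
⌜ imp φ ψ ⌝     = ⌜ φ ⌝ ⇒ ⌜ ψ ⌝
⌜ ball y φ ⌝    = `∀ (var zero ≼ var (suc y) ⇒ ⌜ φ ⌝)
⌜ bex y φ ⌝     = `∃ (var zero ≼ var (suc y) `∧ ⌜ φ ⌝)

_≺_ : ∀ {n} → Term n → Term n → Formula n
s ≺ t = (s ≼ t) `∧ (`¬ (s ≐ t))

∀≤ : ∀ {n} → Term n → Formula (suc n) → Formula n
∀≤ t φ = `∀ (var zero ≼ wkT t ⇒ φ)

∀< : ∀ {n} → Term n → Formula (suc n) → Formula n
∀< t φ = `∀ (var zero ≺ wkT t ⇒ φ)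

v : ∀ {n} (i : ℕ) {p : True (i <? n)} → Term n
v i {p} = var ((# i) {_} {p})

cert : Formula 1
cert =
  (`0 ≼ v 0) `∧
  ∀< (v 0) (`S (v 0) ≼ v 1) `∧
  `∀ ((v 0 ≼ `0) ⇔ (v 0 ≐ `0)) `∧
  ∀< (v 0) (`∀ ((v 0 ≼ `S (v 1)) ⇔ ((v 0 ≼ v 1) `∨ (v 0 ≐ `S (v 1))))) `∧
  ∀≤ (v 0) (∀≤ (v 1) (∀≤ (v 2)
      (`¬ (`S ((v 2 `× v 1) `+ v 0) ≐ `0)))) `∧
  ∀≤ (v 0) (∀≤ (v 1) (∀≤ (v 2) (∀≤ (v 3)
      (`S ((v 3 `× v 2) `+ v 1) ≐ `S (v 0) ⇒ (v 3 `× v 2) `+ v 1 ≐ v 0)))) `∧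
  ∀≤ (v 0) (∀≤ (v 1) ((v 1 `× v 0) `+ `0 ≐ v 1 `× v 0)) `∧
  ∀≤ (v 0) (∀≤ (v 1) (∀≤ (v 2)
      ((v 2 `× v 1) `+ `S (v 0) ≐ `S ((v 2 `× v 1) `+ v 0)))) `∧
  ∀≤ (v 0) (v 0 `× `0 ≐ `0) `∧
  ∀≤ (v 0) (∀≤ (v 1) (v 1 `× `S (v 0) ≐ (v 1 `× v 0) `+ v 1))

sig : PureΔ₀ 1 → Sentence
sig σ₀ = `∃ ⌜ σ₀ ⌝

sigCert : PureΔ₀ 1 → Sentence
sigCert σ₀ = `∃ (cert `∧ ⌜ σ₀ ⌝)

{-# OPTIONS --safe #-}
-- (1) is ∃-elimination.  (2) is Σ₁-completeness of R₀: R₀ decides every bounded formula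
-- at numerals (atoms by computing with its axioms, a bounded quantifier by expanding it into
-- the finite disjunction provided by ∀x (x ≤ n̄ → ⋁ x = ī)), and cert(n̄) ∧ σ₀(n̄) is a true
-- bounded sentence.  (3): argue under cert(V) ∧ σ₀(V).  Once 0̄, …, B−1 are provably below V,
-- A1–A10 give the recursion equations of +, × and ≤ on numerals ≤ B, which is all the same
-- decision procedure needs.  Comparing V with 0̄, 1̄, … in turn, either V exceeds every numeral
-- of a given axiom of R₀, which then follows, or V = ī with all numerals ≤ ī certified; then
-- the procedure refutes σ₀(ī), as ℕ ⊨ ¬σ, contradicting σ₀(V).

module Submission where

open import Defs
open import Data.Nat using (ℕ; zero; suc; _+_; _*_; _≤_; _<_; z≤n; s≤s; _≟_; _≤?_)
open import Data.Nat.Properties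
open import Data.Fin using (Fin; zero; suc)
open import Data.Product using (Σ; ∃; _×_; _,_; proj₁; proj₂)
open import Data.Sum using (_⊎_; inj₁; inj₂; swap; [_,_]′)
open import Data.Empty using (⊥-elim)
open import Data.Unit using (⊤; tt)
open import Function using (_∘_)
open import Relation.Nullary using (¬_; yes; no)
open import Relation.Binary.PropositionalEquality
  using (_≡_; _≢_; refl; sym; trans; cong; cong₂; subst₂; _≗_)

lift-cong : ∀ {n m} {ρ ρ' : Fin n → Fin m} → ρ ≗ ρ' → lift ρ ≗ lift ρ'
lift-cong e zero    = refl
lift-cong e (suc i) = cong suc (e i)

tren-cong : ∀ {n m} {ρ ρ' : Fin n → Fin m} → ρ ≗ ρ' → (t : Term n) → tren ρ t ≡ tren ρ' t
tren-cong e (var i)  = cong var (e i)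
tren-cong e `0       = refl
tren-cong e (`S t)   = cong `S (tren-cong e t)
tren-cong e (s `+ t) = cong₂ _`+_ (tren-cong e s) (tren-cong e t)
tren-cong e (s `× t) = cong₂ _`×_ (tren-cong e s) (tren-cong e t)

fren-cong : ∀ {n m} {ρ ρ' : Fin n → Fin m} → ρ ≗ ρ' → (φ : Formula n) → fren ρ φ ≡ fren ρ' φ
fren-cong e `⊥       = refl
fren-cong e (s ≐ t)  = cong₂ _≐_ (tren-cong e s) (tren-cong e t)
fren-cong e (s ≼ t)  = cong₂ _≼_ (tren-cong e s) (tren-cong e t)
fren-cong e (`¬ φ)   = cong `¬_ (fren-cong e φ)
fren-cong e (φ `∧ ψ) = cong₂ _`∧_ (fren-cong e φ) (fren-cong e ψ)
fren-cong e (φ `∨ ψ) = cong₂ _`∨_ (fren-cong e φ) (fren-cong e ψ)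
fren-cong e (φ ⇒ ψ)  = cong₂ _⇒_ (fren-cong e φ) (fren-cong e ψ)
fren-cong e (`∀ φ)   = cong `∀ (fren-cong (lift-cong e) φ)
fren-cong e (`∃ φ)   = cong `∃ (fren-cong (lift-cong e) φ)

lift-∘ : ∀ {n m k} (ρ : Fin m → Fin k) (ρ' : Fin n → Fin m) → lift ρ ∘ lift ρ' ≗ lift (ρ ∘ ρ')
lift-∘ ρ ρ' zero    = refl
lift-∘ ρ ρ' (suc i) = refl

tren-∘ : ∀ {n m k} (ρ : Fin m → Fin k) (ρ' : Fin n → Fin m) (t : Term n) →
         tren ρ (tren ρ' t) ≡ tren (ρ ∘ ρ') t
tren-∘ ρ ρ' (var i)  = refl
tren-∘ ρ ρ' `0       = refl
tren-∘ ρ ρ' (`S t)   = cong `S (tren-∘ ρ ρ' t)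
tren-∘ ρ ρ' (s `+ t) = cong₂ _`+_ (tren-∘ ρ ρ' s) (tren-∘ ρ ρ' t)
tren-∘ ρ ρ' (s `× t) = cong₂ _`×_ (tren-∘ ρ ρ' s) (tren-∘ ρ ρ' t)

fren-∘ : ∀ {n m k} (ρ : Fin m → Fin k) (ρ' : Fin n → Fin m) (φ : Formula n) →
         fren ρ (fren ρ' φ) ≡ fren (ρ ∘ ρ') φ
fren-∘ ρ ρ' `⊥       = refl
fren-∘ ρ ρ' (s ≐ t)  = cong₂ _≐_ (tren-∘ ρ ρ' s) (tren-∘ ρ ρ' t)
fren-∘ ρ ρ' (s ≼ t)  = cong₂ _≼_ (tren-∘ ρ ρ' s) (tren-∘ ρ ρ' t)
fren-∘ ρ ρ' (`¬ φ)   = cong `¬_ (fren-∘ ρ ρ' φ)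
fren-∘ ρ ρ' (φ `∧ ψ) = cong₂ _`∧_ (fren-∘ ρ ρ' φ) (fren-∘ ρ ρ' ψ)
fren-∘ ρ ρ' (φ `∨ ψ) = cong₂ _`∨_ (fren-∘ ρ ρ' φ) (fren-∘ ρ ρ' ψ)
fren-∘ ρ ρ' (φ ⇒ ψ)  = cong₂ _⇒_ (fren-∘ ρ ρ' φ) (fren-∘ ρ ρ' ψ)
fren-∘ ρ ρ' (`∀ φ)   = cong `∀ (trans (fren-∘ (lift ρ) (lift ρ') φ) (fren-cong (lift-∘ ρ ρ') φ))
fren-∘ ρ ρ' (`∃ φ)   = cong `∃ (trans (fren-∘ (lift ρ) (lift ρ') φ) (fren-cong (lift-∘ ρ ρ') φ))

exts-cong : ∀ {n m} {σ σ' : Fin n → Term m} → σ ≗ σ' → exts σ ≗ exts σ'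
exts-cong e zero    = refl
exts-cong e (suc i) = cong wkT (e i)

tsub-cong : ∀ {n m} {σ σ' : Fin n → Term m} → σ ≗ σ' → (t : Term n) → tsub σ t ≡ tsub σ' t
tsub-cong e (var i)  = e i
tsub-cong e `0       = refl
tsub-cong e (`S t)   = cong `S (tsub-cong e t)
tsub-cong e (s `+ t) = cong₂ _`+_ (tsub-cong e s) (tsub-cong e t)
tsub-cong e (s `× t) = cong₂ _`×_ (tsub-cong e s) (tsub-cong e t)

fsub-cong : ∀ {n m} {σ σ' : Fin n → Term m} → σ ≗ σ' → (φ : Formula n) → fsub σ φ ≡ fsub σ' φ
fsub-cong e `⊥       = refl
fsub-cong e (s ≐ t)  = cong₂ _≐_ (tsub-cong e s) (tsub-cong e t)
fsub-cong e (s ≼ t)  = cong₂ _≼_ (tsub-cong e s) (tsub-cong e t)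
fsub-cong e (`¬ φ)   = cong `¬_ (fsub-cong e φ)
fsub-cong e (φ `∧ ψ) = cong₂ _`∧_ (fsub-cong e φ) (fsub-cong e ψ)
fsub-cong e (φ `∨ ψ) = cong₂ _`∨_ (fsub-cong e φ) (fsub-cong e ψ)
fsub-cong e (φ ⇒ ψ)  = cong₂ _⇒_ (fsub-cong e φ) (fsub-cong e ψ)
fsub-cong e (`∀ φ)   = cong `∀ (fsub-cong (exts-cong e) φ)
fsub-cong e (`∃ φ)   = cong `∃ (fsub-cong (exts-cong e) φ)

tsub-tren : ∀ {n m k} (σ : Fin m → Term k) (ρ : Fin n → Fin m) (t : Term n) →
            tsub σ (tren ρ t) ≡ tsub (σ ∘ ρ) t
tsub-tren σ ρ (var i)  = refl
tsub-tren σ ρ `0       = refl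
tsub-tren σ ρ (`S t)   = cong `S (tsub-tren σ ρ t)
tsub-tren σ ρ (s `+ t) = cong₂ _`+_ (tsub-tren σ ρ s) (tsub-tren σ ρ t)
tsub-tren σ ρ (s `× t) = cong₂ _`×_ (tsub-tren σ ρ s) (tsub-tren σ ρ t)

exts-lift : ∀ {n m k} (σ : Fin m → Term k) (ρ : Fin n → Fin m) → exts σ ∘ lift ρ ≗ exts (σ ∘ ρ)
exts-lift σ ρ zero    = refl
exts-lift σ ρ (suc i) = refl

fsub-fren : ∀ {n m k} (σ : Fin m → Term k) (ρ : Fin n → Fin m) (φ : Formula n) →
            fsub σ (fren ρ φ) ≡ fsub (σ ∘ ρ) φ
fsub-fren σ ρ `⊥       = refl
fsub-fren σ ρ (s ≐ t)  = cong₂ _≐_ (tsub-tren σ ρ s) (tsub-tren σ ρ t)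
fsub-fren σ ρ (s ≼ t)  = cong₂ _≼_ (tsub-tren σ ρ s) (tsub-tren σ ρ t)
fsub-fren σ ρ (`¬ φ)   = cong `¬_ (fsub-fren σ ρ φ)
fsub-fren σ ρ (φ `∧ ψ) = cong₂ _`∧_ (fsub-fren σ ρ φ) (fsub-fren σ ρ ψ)
fsub-fren σ ρ (φ `∨ ψ) = cong₂ _`∨_ (fsub-fren σ ρ φ) (fsub-fren σ ρ ψ)
fsub-fren σ ρ (φ ⇒ ψ)  = cong₂ _⇒_ (fsub-fren σ ρ φ) (fsub-fren σ ρ ψ)
fsub-fren σ ρ (`∀ φ)   = cong `∀ (trans (fsub-fren (exts σ) (lift ρ) φ) (fsub-cong (exts-lift σ ρ) φ))
fsub-fren σ ρ (`∃ φ)   = cong `∃ (trans (fsub-fren (exts σ) (lift ρ) φ) (fsub-cong (exts-lift σ ρ) φ))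

tren-tsub : ∀ {n m k} (ρ : Fin m → Fin k) (σ : Fin n → Term m) (t : Term n) →
            tren ρ (tsub σ t) ≡ tsub (tren ρ ∘ σ) t
tren-tsub ρ σ (var i)  = refl
tren-tsub ρ σ `0       = refl
tren-tsub ρ σ (`S t)   = cong `S (tren-tsub ρ σ t)
tren-tsub ρ σ (s `+ t) = cong₂ _`+_ (tren-tsub ρ σ s) (tren-tsub ρ σ t)
tren-tsub ρ σ (s `× t) = cong₂ _`×_ (tren-tsub ρ σ s) (tren-tsub ρ σ t)

lift-exts : ∀ {n m k} (ρ : Fin m → Fin k) (σ : Fin n → Term m) →
            tren (lift ρ) ∘ exts σ ≗ exts (tren ρ ∘ σ)
lift-exts ρ σ zero    = refl
lift-exts ρ σ (suc i) = trans (tren-∘ (lift ρ) suc (σ i)) (sym (tren-∘ suc ρ (σ i)))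

fren-fsub : ∀ {n m k} (ρ : Fin m → Fin k) (σ : Fin n → Term m) (φ : Formula n) →
            fren ρ (fsub σ φ) ≡ fsub (tren ρ ∘ σ) φ
fren-fsub ρ σ `⊥       = refl
fren-fsub ρ σ (s ≐ t)  = cong₂ _≐_ (tren-tsub ρ σ s) (tren-tsub ρ σ t)
fren-fsub ρ σ (s ≼ t)  = cong₂ _≼_ (tren-tsub ρ σ s) (tren-tsub ρ σ t)
fren-fsub ρ σ (`¬ φ)   = cong `¬_ (fren-fsub ρ σ φ)
fren-fsub ρ σ (φ `∧ ψ) = cong₂ _`∧_ (fren-fsub ρ σ φ) (fren-fsub ρ σ ψ)
fren-fsub ρ σ (φ `∨ ψ) = cong₂ _`∨_ (fren-fsub ρ σ φ) (fren-fsub ρ σ ψ)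
fren-fsub ρ σ (φ ⇒ ψ)  = cong₂ _⇒_ (fren-fsub ρ σ φ) (fren-fsub ρ σ ψ)
fren-fsub ρ σ (`∀ φ)   = cong `∀ (trans (fren-fsub (lift ρ) (exts σ) φ) (fsub-cong (lift-exts ρ σ) φ))
fren-fsub ρ σ (`∃ φ)   = cong `∃ (trans (fren-fsub (lift ρ) (exts σ) φ) (fsub-cong (lift-exts ρ σ) φ))

tsub-∘ : ∀ {n m k} (τ : Fin m → Term k) (σ : Fin n → Term m) (t : Term n) →
         tsub τ (tsub σ t) ≡ tsub (tsub τ ∘ σ) t
tsub-∘ τ σ (var i)  = refl
tsub-∘ τ σ `0       = refl
tsub-∘ τ σ (`S t)   = cong `S (tsub-∘ τ σ t)
tsub-∘ τ σ (s `+ t) = cong₂ _`+_ (tsub-∘ τ σ s) (tsub-∘ τ σ t)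
tsub-∘ τ σ (s `× t) = cong₂ _`×_ (tsub-∘ τ σ s) (tsub-∘ τ σ t)

exts-∘ : ∀ {n m k} (τ : Fin m → Term k) (σ : Fin n → Term m) →
         tsub (exts τ) ∘ exts σ ≗ exts (tsub τ ∘ σ)
exts-∘ τ σ zero    = refl
exts-∘ τ σ (suc i) = trans (tsub-tren (exts τ) suc (σ i)) (sym (tren-tsub suc τ (σ i)))

fsub-∘ : ∀ {n m k} (τ : Fin m → Term k) (σ : Fin n → Term m) (φ : Formula n) →
         fsub τ (fsub σ φ) ≡ fsub (tsub τ ∘ σ) φ
fsub-∘ τ σ `⊥       = refl
fsub-∘ τ σ (s ≐ t)  = cong₂ _≐_ (tsub-∘ τ σ s) (tsub-∘ τ σ t)
fsub-∘ τ σ (s ≼ t)  = cong₂ _≼_ (tsub-∘ τ σ s) (tsub-∘ τ σ t)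
fsub-∘ τ σ (`¬ φ)   = cong `¬_ (fsub-∘ τ σ φ)
fsub-∘ τ σ (φ `∧ ψ) = cong₂ _`∧_ (fsub-∘ τ σ φ) (fsub-∘ τ σ ψ)
fsub-∘ τ σ (φ `∨ ψ) = cong₂ _`∨_ (fsub-∘ τ σ φ) (fsub-∘ τ σ ψ)
fsub-∘ τ σ (φ ⇒ ψ)  = cong₂ _⇒_ (fsub-∘ τ σ φ) (fsub-∘ τ σ ψ)
fsub-∘ τ σ (`∀ φ)   = cong `∀ (trans (fsub-∘ (exts τ) (exts σ) φ) (fsub-cong (exts-∘ τ σ) φ))
fsub-∘ τ σ (`∃ φ)   = cong `∃ (trans (fsub-∘ (exts τ) (exts σ) φ) (fsub-cong (exts-∘ τ σ) φ))

exts-var : ∀ {n} → exts {n} var ≗ var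
exts-var zero    = refl
exts-var (suc i) = refl

tsub-var : ∀ {n} (t : Term n) → tsub var t ≡ t
tsub-var (var i)  = refl
tsub-var `0       = refl
tsub-var (`S t)   = cong `S (tsub-var t)
tsub-var (s `+ t) = cong₂ _`+_ (tsub-var s) (tsub-var t)
tsub-var (s `× t) = cong₂ _`×_ (tsub-var s) (tsub-var t)

fsub-var : ∀ {n} (φ : Formula n) → fsub var φ ≡ φ
fsub-var `⊥       = refl
fsub-var (s ≐ t)  = cong₂ _≐_ (tsub-var s) (tsub-var t)
fsub-var (s ≼ t)  = cong₂ _≼_ (tsub-var s) (tsub-var t)
fsub-var (`¬ φ)   = cong `¬_ (fsub-var φ)
fsub-var (φ `∧ ψ) = cong₂ _`∧_ (fsub-var φ) (fsub-var ψ)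
fsub-var (φ `∨ ψ) = cong₂ _`∨_ (fsub-var φ) (fsub-var ψ)
fsub-var (φ ⇒ ψ)  = cong₂ _⇒_ (fsub-var φ) (fsub-var ψ)
fsub-var (`∀ φ)   = cong `∀ (trans (fsub-cong exts-var φ) (fsub-var φ))
fsub-var (`∃ φ)   = cong `∃ (trans (fsub-cong exts-var φ) (fsub-var φ))

fsub-pointwise-var : ∀ {n} {σ : Fin n → Term n} → σ ≗ var → (φ : Formula n) → fsub σ φ ≡ φ
fsub-pointwise-var e φ = trans (fsub-cong e φ) (fsub-var φ)

sub0-wkT : ∀ {n} (u s : Term n) → tsub (sub0 u) (wkT s) ≡ s
sub0-wkT u s = trans (tsub-tren (sub0 u) suc s) (tsub-var s)

_∷ₛ_ : ∀ {n m} → Term m → (Fin n → Term m) → Fin (suc n) → Term m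
(t ∷ₛ σ) zero    = t
(t ∷ₛ σ) (suc i) = σ i

sub0-exts : ∀ {n m} (t : Term m) (σ : Fin n → Term m) (φ : Formula (suc n)) →
            fsub (exts σ) φ [ t ] ≡ fsub (t ∷ₛ σ) φ
sub0-exts t σ φ = trans (fsub-∘ (sub0 t) (exts σ) φ) (fsub-cong pointwise φ)
  where
  pointwise : tsub (sub0 t) ∘ exts σ ≗ t ∷ₛ σ
  pointwise zero    = refl
  pointwise (suc i) = sub0-wkT t (σ i)

tren-num : ∀ {n m} (ρ : Fin n → Fin m) k → tren ρ (num k) ≡ num k
tren-num ρ zero    = refl
tren-num ρ (suc k) = cong `S (tren-num ρ k)

tsub-num : ∀ {n m} (σ : Fin n → Term m) k → tsub σ (num k) ≡ num k
tsub-num σ zero    = refl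
tsub-num σ (suc k) = cong `S (tsub-num σ k)

fsub-bigOr : ∀ {n m} (σ : Fin n → Term m) t k → fsub σ (bigOr t k) ≡ bigOr (tsub σ t) k
fsub-bigOr σ t zero    = cong (tsub σ t ≐_) (tsub-num σ zero)
fsub-bigOr σ t (suc k) = cong₂ _`∨_ (fsub-bigOr σ t k) (cong (tsub σ t ≐_) (tsub-num σ (suc k)))

fren-bigOr : ∀ {n m} (ρ : Fin n → Fin m) t k → fren ρ (bigOr t k) ≡ bigOr (tren ρ t) k
fren-bigOr ρ t zero    = refl
fren-bigOr ρ t (suc k) = cong₂ _`∨_ (fren-bigOr ρ t k) (cong (tren ρ t ≐_) (tren-num ρ (suc k)))

_⟪_⟫ : ∀ {k m} → Formula k → (Fin k → ℕ) → Formula m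
φ ⟪ ρ ⟫ = fsub (λ i → num (ρ i)) φ

wkF-⟪⟫ : ∀ {k m} (φ : Formula k) (ρ : Fin k → ℕ) → wkF {m} (φ ⟪ ρ ⟫) ≡ φ ⟪ ρ ⟫
wkF-⟪⟫ φ ρ = trans (fren-fsub suc _ φ) (fsub-cong (λ i → tren-num suc (ρ i)) φ)

⟪⟫-[num] : ∀ {k m} (φ : Formula (suc k)) (ρ : Fin k → ℕ) i →
           fsub (exts {m = m} (λ j → num (ρ j))) φ [ num i ] ≡ φ ⟪ i ∷ᵉ ρ ⟫
⟪⟫-[num] φ ρ i = trans (sub0-exts (num i) _ φ) (fsub-cong (λ { zero → refl ; (suc j) → refl }) φ)

⊢-cast : ∀ {n} {Γ : Ctx n} {A B} → A ≡ B → Γ ⊢ A → Γ ⊢ B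
⊢-cast refl d = d

assume : ∀ {n} {Γ : Ctx n} {φ} → (Γ ,, φ) ⊢ φ
assume = hyp (inj₂ refl)

infix 4 _⊆_
record _⊆_ {n} (Γ Δ : Ctx n) : Set where
  constructor ⊆-intro
  field ⊆-elim : ∀ {φ} → Γ φ → Δ φ
open _⊆_

⊆-trans : ∀ {n} {Γ Δ E : Ctx n} → Γ ⊆ Δ → Δ ⊆ E → Γ ⊆ E
⊆-trans f g = ⊆-intro (⊆-elim g ∘ ⊆-elim f)

⊆-refl : ∀ {n} {Γ : Ctx n} → Γ ⊆ Γ
⊆-refl = ⊆-intro (λ x → x)

⊆-,, : ∀ {n} {Γ Δ : Ctx n} {φ} → Γ ⊆ Δ → (Γ ,, φ) ⊆ (Δ ,, φ)
⊆-,, f = ⊆-intro λ { (inj₁ x) → inj₁ (⊆-elim f x) ; (inj₂ e) → inj₂ e }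

⊆-↑ : ∀ {n} {Γ Δ : Ctx n} → Γ ⊆ Δ → (↑ Γ) ⊆ (↑ Δ)
⊆-↑ f = ⊆-intro λ { (χ , χ∈Γ , e) → χ , ⊆-elim f χ∈Γ , e }

⊆-extend : ∀ {n} {Γ : Ctx n} {φ} → Γ ⊆ (Γ ,, φ)
⊆-extend = ⊆-intro inj₁

⊢-mono : ∀ {n} {Γ Δ : Ctx n} {φ} → Γ ⊆ Δ → Γ ⊢ φ → Δ ⊢ φ
⊢-mono f (hyp x)          = hyp (⊆-elim f x)
⊢-mono f (⊥E d)           = ⊥E (⊢-mono f d)
⊢-mono f (¬I d)           = ¬I (⊢-mono (⊆-,, f) d)
⊢-mono f (¬E d e)         = ¬E (⊢-mono f d) (⊢-mono f e)
⊢-mono f (raa d)          = raa (⊢-mono (⊆-,, f) d)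
⊢-mono f (∧I d e)         = ∧I (⊢-mono f d) (⊢-mono f e)
⊢-mono f (∧E₁ d)          = ∧E₁ (⊢-mono f d)
⊢-mono f (∧E₂ d)          = ∧E₂ (⊢-mono f d)
⊢-mono f (∨I₁ d)          = ∨I₁ (⊢-mono f d)
⊢-mono f (∨I₂ d)          = ∨I₂ (⊢-mono f d)
⊢-mono f (∨E d e g)       = ∨E (⊢-mono f d) (⊢-mono (⊆-,, f) e) (⊢-mono (⊆-,, f) g)
⊢-mono f (⇒I d)           = ⇒I (⊢-mono (⊆-,, f) d)
⊢-mono f (⇒E d e)         = ⇒E (⊢-mono f d) (⊢-mono f e)
⊢-mono f (∀I d)           = ∀I (⊢-mono (⊆-↑ f) d)
⊢-mono f (∀E t d)         = ∀E t (⊢-mono f d)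
⊢-mono f (∃I t d)         = ∃I t (⊢-mono f d)
⊢-mono f (∃E d e)         = ∃E (⊢-mono f d) (⊢-mono (⊆-,, (⊆-↑ f)) e)
⊢-mono f (≐refl t)        = ≐refl t
⊢-mono f (≐subst φ d e)   = ≐subst φ (⊢-mono f d) (⊢-mono f e)

⊢-weaken : ∀ {n} {Γ : Ctx n} {φ ψ} → Γ ⊢ ψ → (Γ ,, φ) ⊢ ψ
⊢-weaken = ⊢-mono ⊆-extend

fren-[] : ∀ {n m} (ρ : Fin n → Fin m) (t : Term n) (φ : Formula (suc n)) →
          fren ρ (φ [ t ]) ≡ fren (lift ρ) φ [ tren ρ t ]
fren-[] ρ t φ =
  trans (fren-fsub ρ (sub0 t) φ) (trans (fsub-cong pointwise φ) (sym (fsub-fren _ (lift ρ) φ)))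
  where
  pointwise : tren ρ ∘ sub0 t ≗ sub0 (tren ρ t) ∘ lift ρ
  pointwise zero    = refl
  pointwise (suc i) = refl

fren-lift-wkF : ∀ {n m} (ρ : Fin n → Fin m) (φ : Formula n) → fren (lift ρ) (wkF φ) ≡ wkF (fren ρ φ)
fren-lift-wkF ρ φ = trans (fren-∘ (lift ρ) suc φ) (sym (fren-∘ suc ρ φ))

record _⊆[_]_ {n m} (Γ : Ctx n) (ρ : Fin n → Fin m) (Δ : Ctx m) : Set where
  constructor ren-ctx
  field ⊆-ren : ∀ {ψ} → Γ ψ → Δ (fren ρ ψ)
open _⊆[_]_

⊆[]-,, : ∀ {n m} {ρ : Fin n → Fin m} {Γ Δ φ} → Γ ⊆[ ρ ] Δ → (Γ ,, φ) ⊆[ ρ ] (Δ ,, fren ρ φ)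
⊆[]-,, f = ren-ctx λ { (inj₁ x) → inj₁ (⊆-ren f x) ; (inj₂ refl) → inj₂ refl }

⊆[]-↑ : ∀ {n m} {ρ : Fin n → Fin m} {Γ Δ} → Γ ⊆[ ρ ] Δ → (↑ Γ) ⊆[ lift ρ ] (↑ Δ)
⊆[]-↑ {ρ = ρ} f = ren-ctx λ { (χ , χ∈Γ , refl) → fren ρ χ , ⊆-ren f χ∈Γ , fren-lift-wkF ρ χ }

⊢-ren : ∀ {n m} (ρ : Fin n → Fin m) {Γ : Ctx n} {Δ : Ctx m} {φ} → Γ ⊆[ ρ ] Δ → Γ ⊢ φ → Δ ⊢ fren ρ φ
⊢-ren ρ f (hyp x)      = hyp (⊆-ren f x)
⊢-ren ρ f (⊥E d)       = ⊥E (⊢-ren ρ f d)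
⊢-ren ρ f (¬I d)       = ¬I (⊢-ren ρ (⊆[]-,, f) d)
⊢-ren ρ f (¬E d e)     = ¬E (⊢-ren ρ f d) (⊢-ren ρ f e)
⊢-ren ρ f (raa d)      = raa (⊢-ren ρ (⊆[]-,, f) d)
⊢-ren ρ f (∧I d e)     = ∧I (⊢-ren ρ f d) (⊢-ren ρ f e)
⊢-ren ρ f (∧E₁ d)      = ∧E₁ (⊢-ren ρ f d)
⊢-ren ρ f (∧E₂ d)      = ∧E₂ (⊢-ren ρ f d)
⊢-ren ρ f (∨I₁ d)      = ∨I₁ (⊢-ren ρ f d)
⊢-ren ρ f (∨I₂ d)      = ∨I₂ (⊢-ren ρ f d)
⊢-ren ρ f (∨E d e g)   = ∨E (⊢-ren ρ f d) (⊢-ren ρ (⊆[]-,, f) e) (⊢-ren ρ (⊆[]-,, f) g)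
⊢-ren ρ f (⇒I d)       = ⇒I (⊢-ren ρ (⊆[]-,, f) d)
⊢-ren ρ f (⇒E d e)     = ⇒E (⊢-ren ρ f d) (⊢-ren ρ f e)
⊢-ren ρ f (∀I d)       = ∀I (⊢-ren (lift ρ) (⊆[]-↑ f) d)
⊢-ren ρ f (∀E {φ = φ} t d) =
  ⊢-cast (sym (fren-[] ρ t φ)) (∀E (tren ρ t) (⊢-ren ρ f d))
⊢-ren ρ f (∃I {φ = φ} t d) = ∃I (tren ρ t) (⊢-cast (fren-[] ρ t φ) (⊢-ren ρ f d))
⊢-ren ρ f (∃E {ψ = ψ} d e) =
  ∃E (⊢-ren ρ f d) (⊢-cast (fren-lift-wkF ρ ψ) (⊢-ren (lift ρ) (⊆[]-,, (⊆[]-↑ f)) e))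
⊢-ren ρ f (≐refl t)    = ≐refl (tren ρ t)
⊢-ren ρ f (≐subst {s = s} {t = t} φ d e) =
  ⊢-cast (sym (fren-[] ρ t φ))
    (≐subst (fren (lift ρ) φ) (⊢-ren ρ f d) (⊢-cast (fren-[] ρ s φ) (⊢-ren ρ f e)))

⊢-wk : ∀ {n} {Γ : Ctx n} {φ} → Γ ⊢ φ → ↑ Γ ⊢ wkF φ
⊢-wk = ⊢-ren suc (ren-ctx λ χ∈Γ → _ , χ∈Γ , refl)

⊢-wk⟪⟫ : ∀ {k m} {Γ : Ctx m} (φ : Formula k) {ρ : Fin k → ℕ} → Γ ⊢ φ ⟪ ρ ⟫ → ↑ Γ ⊢ φ ⟪ ρ ⟫
⊢-wk⟪⟫ φ {ρ} d = ⊢-cast (wkF-⟪⟫ φ ρ) (⊢-wk d)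

≐-transport : ∀ {n} {Γ : Ctx n} {s t : Term n} (Φ : Formula (suc n)) {A B} →
              Φ [ s ] ≡ A → Φ [ t ] ≡ B → Γ ⊢ s ≐ t → Γ ⊢ A → Γ ⊢ B
≐-transport Φ refl refl = ≐subst Φ

≐-sym : ∀ {n} {Γ : Ctx n} {s t} → Γ ⊢ s ≐ t → Γ ⊢ t ≐ s
≐-sym {s = s} d =
  ≐-transport (var zero ≐ wkT s) (cong (_ ≐_) (sub0-wkT _ s)) (cong (_ ≐_) (sub0-wkT _ s)) d (≐refl s)

≐-trans : ∀ {n} {Γ : Ctx n} {s t u} → Γ ⊢ s ≐ t → Γ ⊢ t ≐ u → Γ ⊢ s ≐ u
≐-trans {s = s} d e =
  ≐-transport (wkT s ≐ var zero) (cong (_≐ _) (sub0-wkT _ s)) (cong (_≐ _) (sub0-wkT _ s)) e d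

≐-cong : ∀ {n} {Γ : Ctx n} {s s'} (C : Term (suc n)) →
         Γ ⊢ s ≐ s' → Γ ⊢ tsub (sub0 s) C ≐ tsub (sub0 s') C
≐-cong {s = s} {s'} C d =
  ≐-transport (wkT (tsub (sub0 s) C) ≐ C)
    (cong (_≐ tsub (sub0 s) C) (sub0-wkT s _)) (cong (_≐ tsub (sub0 s') C) (sub0-wkT s' _)) d (≐refl _)

≐-S : ∀ {n} {Γ : Ctx n} {s s'} → Γ ⊢ s ≐ s' → Γ ⊢ `S s ≐ `S s'
≐-S = ≐-cong (`S (var zero))

≐-+ : ∀ {n} {Γ : Ctx n} {s s' t t'} → Γ ⊢ s ≐ s' → Γ ⊢ t ≐ t' → Γ ⊢ s `+ t ≐ s' `+ t'
≐-+ {Γ = Γ} {s} {s'} {t} {t'} d e = ≐-trans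
  (subst₂ (λ a b → Γ ⊢ s `+ a ≐ s' `+ b) (sub0-wkT s t) (sub0-wkT s' t) (≐-cong (var zero `+ wkT t) d))
  (subst₂ (λ a b → Γ ⊢ a `+ t ≐ b `+ t') (sub0-wkT t s') (sub0-wkT t' s') (≐-cong (wkT s' `+ var zero) e))

≐-× : ∀ {n} {Γ : Ctx n} {s s' t t'} → Γ ⊢ s ≐ s' → Γ ⊢ t ≐ t' → Γ ⊢ s `× t ≐ s' `× t'
≐-× {Γ = Γ} {s} {s'} {t} {t'} d e = ≐-trans
  (subst₂ (λ a b → Γ ⊢ s `× a ≐ s' `× b) (sub0-wkT s t) (sub0-wkT s' t) (≐-cong (var zero `× wkT t) d))
  (subst₂ (λ a b → Γ ⊢ a `× t ≐ b `× t') (sub0-wkT t s') (sub0-wkT t' s') (≐-cong (wkT s' `× var zero) e))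

contrapositive : ∀ {n} {Γ : Ctx n} {A B} → Γ ⊢ A ⇒ B → Γ ⊢ `¬ B → Γ ⊢ `¬ A
contrapositive A⇒B ¬B = ¬I (¬E (⊢-weaken ¬B) (⇒E (⊢-weaken A⇒B) assume))

≼-resp : ∀ {n} {Γ : Ctx n} {s s' t t'} → Γ ⊢ s ≐ s' → Γ ⊢ t ≐ t' → Γ ⊢ s ≼ t → Γ ⊢ s' ≼ t'
≼-resp {s = s} {s'} {t} d e s≼t =
  ≐-transport (wkT s' ≼ var zero) (cong (_≼ _) (sub0-wkT _ s')) (cong (_≼ _) (sub0-wkT _ s')) e
    (≐-transport (var zero ≼ wkT t) (cong (_ ≼_) (sub0-wkT _ t)) (cong (_ ≼_) (sub0-wkT _ t)) d s≼t)

≉-resp : ∀ {n} {Γ : Ctx n} {s s' t t'} → Γ ⊢ s ≐ s' → Γ ⊢ t ≐ t' → Γ ⊢ `¬ (s' ≐ t') → Γ ⊢ `¬ (s ≐ t)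
≉-resp d e = contrapositive (⇒I (≐-trans (≐-sym (⊢-weaken d)) (≐-trans assume (⊢-weaken e))))

⋠-resp : ∀ {n} {Γ : Ctx n} {s s' t t'} → Γ ⊢ s ≐ s' → Γ ⊢ t ≐ t' → Γ ⊢ `¬ (s' ≼ t') → Γ ⊢ `¬ (s ≼ t)
⋠-resp d e = contrapositive (⇒I (≼-resp (⊢-weaken d) (⊢-weaken e) assume))

≉-sym : ∀ {n} {Γ : Ctx n} {s t} → Γ ⊢ `¬ (s ≐ t) → Γ ⊢ `¬ (t ≐ s)
≉-sym s≉t = ¬I (¬E (⊢-weaken s≉t) (≐-sym assume))

by-cases : ∀ {n} {Γ : Ctx n} (A : Formula n) {G} → (Γ ,, A) ⊢ G → (Γ ,, `¬ A) ⊢ G → Γ ⊢ G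
by-cases A = ∨E (raa (¬E assume (∨I₂ (¬I (¬E (⊢-weaken assume) (∨I₁ assume))))))

∀E-exts : ∀ {n m} {Γ : Ctx m} {σ : Fin n → Term m} {φ : Formula (suc n)} →
          Γ ⊢ `∀ (fsub (exts σ) φ) → (t : Term m) → Γ ⊢ fsub (t ∷ₛ σ) φ
∀E-exts {σ = σ} {φ} d t = ⊢-cast (sub0-exts t σ φ) (∀E t d)

bigOr-elim : ∀ {m} {Γ : Ctx m} {t G} n → Γ ⊢ bigOr t n →
             (∀ i → i ≤ n → (Γ ,, t ≐ num i) ⊢ G) → Γ ⊢ G
bigOr-elim zero    d cases = ⇒E (⇒I (cases 0 z≤n)) d
bigOr-elim (suc n) d cases =
  ∨E d (bigOr-elim n assume (λ i i≤n → ⊢-mono (⊆-,, ⊆-extend) (cases i (m≤n⇒m≤1+n i≤n))))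
       (cases (suc n) ≤-refl)

bigOr-refute : ∀ {m} {Γ : Ctx m} {t} n → (∀ j → j ≤ n → Γ ⊢ `¬ (t ≐ num j)) → Γ ⊢ `¬ bigOr t n
bigOr-refute zero    t≉ = t≉ 0 z≤n
bigOr-refute (suc n) t≉ =
  ¬I (∨E assume (¬E (⊢-weaken (⊢-weaken (bigOr-refute n λ j j≤n → t≉ j (m≤n⇒m≤1+n j≤n)))) assume)
                (¬E (⊢-weaken (⊢-weaken (t≉ (suc n) ≤-refl))) assume))

≐num-≡ : ∀ {n} {Γ : Ctx n} {t a b} → a ≡ b → Γ ⊢ t ≐ num a → Γ ⊢ t ≐ num b
≐num-≡ refl d = d

≐num-subst : ∀ {k m} {Δ : Ctx (suc m)} {i : ℕ} {ρ : Fin k → ℕ} (φ : Formula (suc k)) →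
             Δ ⊢ var zero ≐ num i → Δ ⊢ φ ⟪ i ∷ᵉ ρ ⟫ → Δ ⊢ fsub (exts (λ j → num (ρ j))) φ
≐num-subst {k} {m} {i = i} {ρ} φ x≐i =
  ≐-transport (fsub τ φ) (trans (fsub-∘ _ τ φ) (fsub-cong at-num φ))
                         (trans (fsub-∘ _ τ φ) (fsub-cong at-var φ)) (≐-sym x≐i)
  where
  τ : Fin (suc k) → Term (suc (suc m))
  τ zero    = var zero
  τ (suc j) = num (ρ j)
  at-num : tsub (sub0 (num i)) ∘ τ ≗ λ j → num ((i ∷ᵉ ρ) j)
  at-num zero    = refl
  at-num (suc j) = tsub-num _ (ρ j)
  at-var : tsub (sub0 (var zero)) ∘ τ ≗ exts (λ j → num (ρ j))
  at-var zero    = refl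
  at-var (suc j) = trans (tsub-num _ (ρ j)) (sym (tren-num suc (ρ j)))

fren-lift-suc-[var] : ∀ {n} (φ : Formula (suc n)) → fren (lift suc) φ [ var zero ] ≡ φ
fren-lift-suc-[var] φ = trans (fsub-fren _ (lift suc) φ) (fsub-pointwise-var (λ { zero → refl ; (suc i) → refl }) φ)

∃-∧E₂ : ∀ {n} {Γ : Ctx n} {φ ψ} → Γ ⊢ `∃ (φ `∧ ψ) → Γ ⊢ `∃ ψ
∃-∧E₂ {ψ = ψ} d = ∃E d (∃I (var zero) (⊢-cast (sym (fren-lift-suc-[var] ψ)) (∧E₂ assume)))

fsub-var₀ : (φ : Formula 1) → fsub (λ _ → var zero) φ ≡ φ
fsub-var₀ = fsub-pointwise-var λ { zero → refl }

-- Deciding bounded formulas at numerals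

Decides : ∀ {k m} → Ctx m → Formula k → (Fin k → ℕ) → Set₁
Decides Γ φ ρ = (⟦ φ ⟧ ρ × (Γ ⊢ φ ⟪ ρ ⟫)) ⊎ ((¬ ⟦ φ ⟧ ρ) × (Γ ⊢ `¬ φ ⟪ ρ ⟫))

module _ {k m} {Γ : Ctx m} {ρ : Fin k → ℕ} where

  decides-¬ : ∀ {φ} → Decides Γ φ ρ → Decides Γ (`¬ φ) ρ
  decides-¬ (inj₁ (t , p)) = inj₂ ((λ n → n t) , ¬I (¬E assume (⊢-weaken p)))
  decides-¬ (inj₂ (n , p)) = inj₁ (n , p)

  decides-∧ : ∀ {φ ψ} → Decides Γ φ ρ → Decides Γ ψ ρ → Decides Γ (φ `∧ ψ) ρ
  decides-∧ (inj₁ (ta , pa)) (inj₁ (tb , pb)) = inj₁ ((ta , tb) , ∧I pa pb)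
  decides-∧ (inj₂ (na , pa)) _                = inj₂ (na ∘ proj₁ , ¬I (¬E (⊢-weaken pa) (∧E₁ assume)))
  decides-∧ (inj₁ _) (inj₂ (nb , pb))         = inj₂ (nb ∘ proj₂ , ¬I (¬E (⊢-weaken pb) (∧E₂ assume)))

  decides-∨ : ∀ {φ ψ} → Decides Γ φ ρ → Decides Γ ψ ρ → Decides Γ (φ `∨ ψ) ρ
  decides-∨ (inj₁ (ta , pa)) _                = inj₁ (inj₁ ta , ∨I₁ pa)
  decides-∨ (inj₂ _) (inj₁ (tb , pb))         = inj₁ (inj₂ tb , ∨I₂ pb)
  decides-∨ (inj₂ (na , pa)) (inj₂ (nb , pb)) =
    inj₂ ((λ { (inj₁ a) → na a ; (inj₂ b) → nb b }) ,
          ¬I (∨E assume (¬E (⊢-weaken (⊢-weaken pa)) assume)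
                            (¬E (⊢-weaken (⊢-weaken pb)) assume)))

  decides-⇒ : ∀ {φ ψ} → Decides Γ φ ρ → Decides Γ ψ ρ → Decides Γ (φ ⇒ ψ) ρ
  decides-⇒ (inj₂ (na , pa)) _                = inj₁ (⊥-elim ∘ na , ⇒I (⊥E (¬E (⊢-weaken pa) assume)))
  decides-⇒ (inj₁ _) (inj₁ (tb , pb))         = inj₁ ((λ _ → tb) , ⇒I (⊢-weaken pb))
  decides-⇒ (inj₁ (ta , pa)) (inj₂ (nb , pb)) =
    inj₂ ((λ f → nb (f ta)) , ¬I (¬E (⊢-weaken pb) (⇒E assume (⊢-weaken pa))))

m≤1+n⇒m≤n⊎m≡1+n : ∀ {a n} → a ≤ suc n → a ≤ n ⊎ a ≡ suc n
m≤1+n⇒m≤n⊎m≡1+n a≤1+n with m≤n⇒m<n∨m≡n a≤1+n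
... | inj₁ a<1+n = inj₁ (≤-pred a<1+n)
... | inj₂ a≡1+n = inj₂ a≡1+n

m≤n⊎m≡1+n⇒m≤1+n : ∀ {a n} → a ≤ n ⊎ a ≡ suc n → a ≤ suc n
m≤n⊎m≡1+n⇒m≤1+n (inj₁ a≤n)  = m≤n⇒m≤1+n a≤n
m≤n⊎m≡1+n⇒m≤1+n (inj₂ refl) = ≤-refl

some-or-all : ∀ {ℓ} n {P Q : ℕ → Set ℓ} → (∀ i → i ≤ n → P i ⊎ Q i) →
              (∃ λ i → i ≤ n × P i) ⊎ (∀ i → i ≤ n → Q i)
some-or-all zero    dec with dec 0 z≤n
... | inj₁ p = inj₁ (0 , z≤n , p)
... | inj₂ q = inj₂ λ { .0 z≤n → q }
some-or-all (suc n) dec with some-or-all n (λ i i≤n → dec i (m≤n⇒m≤1+n i≤n)) | dec (suc n) ≤-refl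
... | inj₁ (i , i≤n , p) | _     = inj₁ (i , m≤n⇒m≤1+n i≤n , p)
... | inj₂ _             | inj₁ p = inj₁ (suc n , ≤-refl , p)
... | inj₂ qs            | inj₂ q = inj₂ λ i i≤1+n → [ qs i , (λ { refl → q }) ]′ (m≤1+n⇒m≤n⊎m≡1+n i≤1+n)

Atoms : Set₁
Atoms = ∀ {k} → Formula k → Set

data Bounded (At : Atoms) : ∀ {k} → Formula k → Set
data Guard (At : Atoms) {k} (y : Fin k) : Formula (suc k) → Set

data Bounded At where
  atom : ∀ {k} {α : Formula k} → At α → Bounded At α
  ¬-bd : ∀ {k} {φ : Formula k} → Bounded At φ → Bounded At (`¬ φ)
  ∧-bd : ∀ {k} {φ ψ : Formula k} → Bounded At φ → Bounded At ψ → Bounded At (φ `∧ ψ)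
  ∨-bd : ∀ {k} {φ ψ : Formula k} → Bounded At φ → Bounded At ψ → Bounded At (φ `∨ ψ)
  ⇒-bd : ∀ {k} {φ ψ : Formula k} → Bounded At φ → Bounded At ψ → Bounded At (φ ⇒ ψ)
  ∀-bd : ∀ {k} {y : Fin k} {γ ψ} → Guard At y γ → Bounded At ψ → Bounded At (`∀ (γ ⇒ ψ))
  ∃-bd : ∀ {k} {y : Fin k} {γ} → Guard At y γ → Bounded At (`∃ γ)

data Guard At y where
  ≼-guard  : Guard At y (var zero ≼ var (suc y))
  ≼∧-guard : ∀ {χ} → Bounded At χ → Guard At y (var zero ≼ var (suc y) `∧ χ)

guard-sem : ∀ {At : Atoms} {k} {y : Fin k} {γ} {ρ : Fin k → ℕ} {a} →
            Guard At y γ → ⟦ γ ⟧ (a ∷ᵉ ρ) → a ≤ ρ y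
guard-sem ≼-guard      a≤ρy       = a≤ρy
guard-sem (≼∧-guard _) (a≤ρy , _) = a≤ρy

guard-bound : ∀ {At : Atoms} {k m} {Δ : Ctx (suc m)} {y : Fin k} {γ} {ρ : Fin k → ℕ} → Guard At y γ →
              Δ ⊢ fsub (exts (λ j → num (ρ j))) γ → Δ ⊢ var zero ≼ num (ρ y)
guard-bound {y = y} {ρ = ρ} ≼-guard      d = ⊢-cast (cong (var zero ≼_) (tren-num suc (ρ y))) d
guard-bound {y = y} {ρ = ρ} (≼∧-guard _) d = ⊢-cast (cong (var zero ≼_) (tren-num suc (ρ y))) (∧E₁ d)

data PureAtom : ∀ {k} → Formula k → Set where
  eqv-atom   : ∀ {k} (x y : Fin k)   → PureAtom (var x ≐ var y)
  zeq-atom   : ∀ {k} (x : Fin k)     → PureAtom (`0 ≐ var x)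
  seq-atom   : ∀ {k} (x y : Fin k)   → PureAtom (`S (var x) ≐ var y)
  addeq-atom : ∀ {k} (x y z : Fin k) → PureAtom (var x `+ var y ≐ var z)
  muleq-atom : ∀ {k} (x y z : Fin k) → PureAtom (var x `× var y ≐ var z)
  lev-atom   : ∀ {k} (x y : Fin k)   → PureAtom (var x ≼ var y)

⌜⌝-bounded : ∀ {At : Atoms} → (∀ {k} {α : Formula k} → PureAtom α → At α) →
             ∀ {k} (φ : PureΔ₀ k) → Bounded At ⌜ φ ⌝
⌜⌝-bounded embed (eqv x y)     = atom (embed (eqv-atom x y))
⌜⌝-bounded embed (zeq x)       = atom (embed (zeq-atom x))
⌜⌝-bounded embed (seq x y)     = atom (embed (seq-atom x y))
⌜⌝-bounded embed (addeq x y z) = atom (embed (addeq-atom x y z))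
⌜⌝-bounded embed (muleq x y z) = atom (embed (muleq-atom x y z))
⌜⌝-bounded embed (lev x y)     = atom (embed (lev-atom x y))
⌜⌝-bounded embed (neg φ)       = ¬-bd (⌜⌝-bounded embed φ)
⌜⌝-bounded embed (and φ ψ)     = ∧-bd (⌜⌝-bounded embed φ) (⌜⌝-bounded embed ψ)
⌜⌝-bounded embed (or φ ψ)      = ∨-bd (⌜⌝-bounded embed φ) (⌜⌝-bounded embed ψ)
⌜⌝-bounded embed (imp φ ψ)     = ⇒-bd (⌜⌝-bounded embed φ) (⌜⌝-bounded embed ψ)
⌜⌝-bounded embed (ball y φ)    = ∀-bd ≼-guard (⌜⌝-bounded embed φ)
⌜⌝-bounded embed (bex y φ)     = ∃-bd (≼∧-guard (⌜⌝-bounded embed φ))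

module Decision
  (At : Atoms)
  (Adequate : ∀ {m} → Ctx m → Set₁)
  (InRange : ℕ → Set)
  (inRange-≤ : ∀ {i n} → i ≤ n → InRange n → InRange i)
  (adequate-⊆ : ∀ {m} {Γ Δ : Ctx m} → Γ ⊆ Δ → Adequate Γ → Adequate Δ)
  (adequate-↑ : ∀ {m} {Γ : Ctx m} → Adequate Γ → Adequate (↑ Γ))
  (decide-atom : ∀ {k m} {Γ : Ctx m} {α : Formula k} → At α → (ρ : Fin k → ℕ) →
                 (∀ j → InRange (ρ j)) → Adequate Γ → Decides Γ α ρ)
  (≼num⇒bigOr : ∀ {m} {Γ : Ctx m} {t n} → InRange n → Adequate Γ → Γ ⊢ t ≼ num n → Γ ⊢ bigOr t n)
  (num≼num : ∀ {m} {Γ : Ctx m} {i n} → i ≤ n → InRange n → Adequate Γ → Γ ⊢ num i ≼ num n)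
  where

  InRanges : ∀ {k} → (Fin k → ℕ) → Set
  InRanges ρ = ∀ j → InRange (ρ j)

  ∷-inRanges : ∀ {k i} {ρ : Fin k → ℕ} → InRange i → InRanges ρ → InRanges (i ∷ᵉ ρ)
  ∷-inRanges ri r zero    = ri
  ∷-inRanges ri r (suc j) = r j

  decide : ∀ {k m} {Γ : Ctx m} {φ : Formula k} → Bounded At φ →
           (ρ : Fin k → ℕ) → InRanges ρ → Adequate Γ → Decides Γ φ ρ
  decide-guard : ∀ {k m} {Γ : Ctx m} {y : Fin k} {γ} → Guard At y γ →
                 (ρ : Fin k → ℕ) → InRanges ρ → Adequate Γ → ∀ i → i ≤ ρ y → Decides Γ γ (i ∷ᵉ ρ)

  decide (atom α)   ρ r a = decide-atom α ρ r a
  decide (¬-bd b)   ρ r a = decides-¬ (decide b ρ r a)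
  decide (∧-bd b c) ρ r a = decides-∧ (decide b ρ r a) (decide c ρ r a)
  decide (∨-bd b c) ρ r a = decides-∨ (decide b ρ r a) (decide c ρ r a)
  decide (⇒-bd b c) ρ r a = decides-⇒ (decide b ρ r a) (decide c ρ r a)
  decide {Γ = Γ} (∀-bd {y = y} {γ} {ψ} g b) ρ r a
    with some-or-all (ρ y) (λ i i≤ →
           swap (decides-⇒ (decide-guard g ρ r a i i≤) (decide b (i ∷ᵉ ρ) (r′ i≤) a)))
    where
    r′ : ∀ {i} → i ≤ ρ y → InRanges (i ∷ᵉ ρ)
    r′ i≤ = ∷-inRanges (inRange-≤ i≤ (r y)) r
  ... | inj₁ (i , _ , ¬γ⇒ψ , refutation) =
    inj₂ ((λ h → ¬γ⇒ψ (h i)) ,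
          ¬I (¬E (⊢-weaken refutation) (⊢-cast (⟪⟫-[num] (γ ⇒ ψ) ρ i) (∀E (num i) assume))))
  ... | inj₂ instances = inj₁ ((λ x γx → proj₁ (instances x (guard-sem g γx)) γx) , ∀I (⇒I body))
    where
    body : (↑ Γ ,, fsub (exts (λ j → num (ρ j))) γ) ⊢ fsub (exts (λ j → num (ρ j))) ψ
    body = bigOr-elim (ρ y) (≼num⇒bigOr (r y) (adequate-⊆ ⊆-extend (adequate-↑ a)) (guard-bound g assume))
      λ i i≤ → ⇒E (≐num-subst {i = i} (γ ⇒ ψ) assume
                     (⊢-weaken (⊢-weaken (⊢-wk⟪⟫ (γ ⇒ ψ) (proj₂ (instances i i≤))))))
                  (⊢-weaken assume)
  decide {Γ = Γ} (∃-bd {y = y} {γ} g) ρ r a with some-or-all (ρ y) (decide-guard g ρ r a)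
  ... | inj₁ (i , _ , γi , proof) = inj₁ ((i , γi) , ∃I (num i) (⊢-cast (sym (⟪⟫-[num] γ ρ i)) proof))
  ... | inj₂ refutations =
    inj₂ ((λ (x , γx) → proj₁ (refutations x (guard-sem g γx)) γx) , ¬I (∃E assume body))
    where
    body : (↑ (Γ ,, `∃ (fsub (exts (λ j → num (ρ j))) γ)) ,, fsub (exts (λ j → num (ρ j))) γ) ⊢ `⊥
    body = bigOr-elim (ρ y)
      (≼num⇒bigOr (r y) (adequate-⊆ ⊆-extend (adequate-↑ (adequate-⊆ ⊆-extend a))) (guard-bound g assume))
      λ i i≤ → ¬E (≐num-subst {i = i} (`¬ γ) assume
                     (⊢-weaken (⊢-weaken (⊢-wk⟪⟫ (`¬ γ) (⊢-weaken (proj₂ (refutations i i≤)))))))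
                  (⊢-weaken assume)

  decide-guard {y = y} ≼-guard      ρ r a i i≤ = inj₁ (i≤ , num≼num i≤ (r y) a)
  decide-guard {y = y} (≼∧-guard b) ρ r a i i≤ =
    decides-∧ {φ = var zero ≼ var (suc y)} (decide-guard ≼-guard ρ r a i i≤)
              (decide b (i ∷ᵉ ρ) (∷-inRanges (inRange-≤ i≤ (r y)) r) a)

-- Σ₁-completeness of R₀

-- The axioms of R₀ as formulas of every scope, so that they remain available under binders.
data R₀Axiom : Set where
  plus    : ℕ → ℕ → R₀Axiom
  times   : ℕ → ℕ → R₀Axiom
  apart   : (a b : ℕ) → a ≢ b → R₀Axiom
  bounded : ℕ → R₀Axiom
  ordered : (a b : ℕ) → a ≤ b → R₀Axiom

axiom : ∀ {n} → R₀Axiom → Formula n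
axiom (plus a b)      = num a `+ num b ≐ num (a + b)
axiom (times a b)     = num a `× num b ≐ num (a * b)
axiom (apart a b _)   = `¬ (num a ≐ num b)
axiom (bounded b)     = `∀ (var zero ≼ num b ⇒ bigOr (var zero) b)
axiom (ordered a b _) = num a ≼ num b

R₀-axiom : ∀ {φ} → R₀ φ → Σ R₀Axiom λ ax → φ ≡ axiom ax
R₀-axiom (ax+ a b)      = plus a b , refl
R₀-axiom (ax× a b)      = times a b , refl
R₀-axiom (ax≠ a b a≢b)  = apart a b a≢b , refl
R₀-axiom (ax≤ b)        = bounded b , refl
R₀-axiom (ax≤' a b a≤b) = ordered a b a≤b , refl

fren-axiom : ∀ {n m} (ρ : Fin n → Fin m) ax → fren ρ (axiom ax) ≡ axiom ax
fren-axiom ρ (plus a b)      = cong₂ _≐_ (cong₂ _`+_ (tren-num ρ a) (tren-num ρ b)) (tren-num ρ (a + b))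
fren-axiom ρ (times a b)     = cong₂ _≐_ (cong₂ _`×_ (tren-num ρ a) (tren-num ρ b)) (tren-num ρ (a * b))
fren-axiom ρ (apart a b _)   = cong `¬_ (cong₂ _≐_ (tren-num ρ a) (tren-num ρ b))
fren-axiom ρ (bounded b)     =
  cong `∀ (cong₂ _⇒_ (cong (var zero ≼_) (tren-num (lift ρ) b)) (fren-bigOr (lift ρ) (var zero) b))
fren-axiom ρ (ordered a b _) = cong₂ _≼_ (tren-num ρ a) (tren-num ρ b)

ProvesR₀ : ∀ {m} → Ctx m → Set₁
ProvesR₀ Γ = ∀ ax → Γ ⊢ axiom ax

provesR₀-⊆ : ∀ {m} {Γ Δ : Ctx m} → Γ ⊆ Δ → ProvesR₀ Γ → ProvesR₀ Δ
provesR₀-⊆ Γ⊆Δ p ax = ⊢-mono Γ⊆Δ (p ax)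

provesR₀-, : ∀ {m} {Γ : Ctx m} {φ} → ProvesR₀ Γ → ProvesR₀ (Γ ,, φ)
provesR₀-, = provesR₀-⊆ ⊆-extend

provesR₀-↑ : ∀ {m} {Γ : Ctx m} → ProvesR₀ Γ → ProvesR₀ (↑ Γ)
provesR₀-↑ p ax = ⊢-cast (fren-axiom suc ax) (⊢-wk (p ax))

R₀-provesR₀ : ProvesR₀ R₀
R₀-provesR₀ (plus a b)          = hyp (ax+ a b)
R₀-provesR₀ (times a b)         = hyp (ax× a b)
R₀-provesR₀ (apart a b a≢b)     = hyp (ax≠ a b a≢b)
R₀-provesR₀ (bounded b)         = hyp (ax≤ b)
R₀-provesR₀ (ordered a b a≤b)   = hyp (ax≤' a b a≤b)

A3 : ∀ {k} → Formula k
A3 = `∀ ((var zero ≼ `0) ⇔ (var zero ≐ `0))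

A4-body : ∀ {m} → Term (suc m) → Formula (suc m)
A4-body y = (var zero ≼ `S y) ⇔ ((var zero ≼ y) `∨ (var zero ≐ `S y))

A4 : ∀ {m} → Term m → Formula m
A4 x = `∀ (A4-body (wkT x))

data R₀Atom : Atoms where
  ≐-atom  : ∀ {k} (s t : Term k) → R₀Atom (s ≐ t)
  ≼-atom  : ∀ {k} (s t : Term k) → R₀Atom (s ≼ t)
  A3-atom : ∀ {k} → R₀Atom {k} A3
  A4-atom : ∀ {k} (x : Fin k) → R₀Atom (A4 (var x))

module _ {m} {Γ : Ctx m} (R : ProvesR₀ Γ) where

  ≼num⇒bigOr-R₀ : ∀ {t} n → Γ ⊢ t ≼ num n ⇒ bigOr t n
  ≼num⇒bigOr-R₀ {t} n =
    ⊢-cast (cong₂ _⇒_ (cong (t ≼_) (tsub-num _ n)) (fsub-bigOr _ (var zero) n)) (∀E t (R (bounded n)))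

  num≼num-R₀ : ∀ {a b} → a ≤ b → Γ ⊢ num a ≼ num b
  num≼num-R₀ a≤b = R (ordered _ _ a≤b)

  num≉num-R₀ : ∀ {a b} → a ≢ b → Γ ⊢ `¬ (num a ≐ num b)
  num≉num-R₀ a≢b = R (apart _ _ a≢b)

  num⋠num-R₀ : ∀ {a b} → ¬ a ≤ b → Γ ⊢ `¬ (num a ≼ num b)
  num⋠num-R₀ {b = b} a≰b =
    contrapositive (≼num⇒bigOr-R₀ b) (bigOr-refute b λ j j≤b → num≉num-R₀ λ { refl → a≰b j≤b })

  bigOr⇒≼ : ∀ {t} n K → n ≤ K → Γ ⊢ bigOr t n → Γ ⊢ t ≼ num K
  bigOr⇒≼ n K n≤K d = bigOr-elim n d λ j j≤n →
    ≼-resp (≐-sym assume) (≐refl _) (⊢-weaken (num≼num-R₀ (≤-trans j≤n n≤K)))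

  eval : ∀ {k} (t : Term k) (ρ : Fin k → ℕ) → Γ ⊢ tsub (λ i → num (ρ i)) t ≐ num (⟦ t ⟧t ρ)
  eval (var i)  ρ = ≐refl _
  eval `0       ρ = ≐refl _
  eval (`S t)   ρ = ≐-S (eval t ρ)
  eval (s `+ t) ρ = ≐-trans (≐-+ (eval s ρ) (eval t ρ)) (R (plus _ _))
  eval (s `× t) ρ = ≐-trans (≐-× (eval s ρ) (eval t ρ)) (R (times _ _))

A3-R₀ : ∀ {m} {Γ : Ctx m} → ProvesR₀ Γ → Γ ⊢ A3
A3-R₀ R = ∀I (∧I (≼num⇒bigOr-R₀ (provesR₀-↑ R) 0)
                 (⇒I (≼-resp (≐-sym assume) (≐refl _) (num≼num-R₀ (provesR₀-, (provesR₀-↑ R)) z≤n))))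

A4-R₀ : ∀ {m} {Γ : Ctx m} → ProvesR₀ Γ → ∀ n → Γ ⊢ A4 (num n)
A4-R₀ {Γ = Γ} R n =
  ⊢-cast (cong (`∀ ∘ A4-body) (sym (tren-num suc n))) (∀I (∧I (⇒I forward) (⇒I backward)))
  where
  R↑ : ∀ {φ} → ProvesR₀ (↑ Γ ,, φ)
  R↑ = provesR₀-, (provesR₀-↑ R)
  forward : (↑ Γ ,, var zero ≼ `S (num n)) ⊢ (var zero ≼ num n) `∨ (var zero ≐ `S (num n))
  forward = ∨E (⇒E (≼num⇒bigOr-R₀ R↑ (suc n)) assume)
               (∨I₁ (bigOr⇒≼ (provesR₀-, R↑) n n ≤-refl assume))
               (∨I₂ assume)
  backward : (↑ Γ ,, (var zero ≼ num n) `∨ (var zero ≐ `S (num n))) ⊢ var zero ≼ `S (num n)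
  backward = ∨E assume
    (bigOr⇒≼ (provesR₀-, R↑) n (suc n) (n≤1+n n) (⇒E (≼num⇒bigOr-R₀ (provesR₀-, R↑) n) assume))
    (≼-resp (≐-sym assume) (≐refl _) (num≼num-R₀ (provesR₀-, R↑) ≤-refl))

decide-R₀Atom : ∀ {k m} {Γ : Ctx m} {α : Formula k} → R₀Atom α → (ρ : Fin k → ℕ) →
                ProvesR₀ Γ → Decides Γ α ρ
decide-R₀Atom (≐-atom s t) ρ R with ⟦ s ⟧t ρ ≟ ⟦ t ⟧t ρ
... | yes s≡t = inj₁ (s≡t , ≐-trans (eval R s ρ) (≐-sym (≐num-≡ (sym s≡t) (eval R t ρ))))
... | no s≢t  = inj₂ (s≢t , ≉-resp (eval R s ρ) (eval R t ρ) (num≉num-R₀ R s≢t))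
decide-R₀Atom (≼-atom s t) ρ R with ⟦ s ⟧t ρ ≤? ⟦ t ⟧t ρ
... | yes s≤t = inj₁ (s≤t , ≼-resp (≐-sym (eval R s ρ)) (≐-sym (eval R t ρ)) (num≼num-R₀ R s≤t))
... | no s≰t  = inj₂ (s≰t , ⋠-resp (eval R s ρ) (eval R t ρ) (num⋠num-R₀ R s≰t))
decide-R₀Atom A3-atom     ρ R = inj₁ ((λ a → n≤0⇒n≡0 , λ { refl → z≤n }) , A3-R₀ R)
decide-R₀Atom (A4-atom x) ρ R =
  inj₁ ((λ a → m≤1+n⇒m≤n⊎m≡1+n , m≤n⊎m≡1+n⇒m≤1+n) , A4-R₀ R (ρ x))

module R₀-Decision = Decision R₀Atom ProvesR₀ (λ _ → ⊤) (λ _ _ → tt) provesR₀-⊆ provesR₀-↑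
  (λ α ρ _ → decide-R₀Atom α ρ) (λ _ R → ⇒E (≼num⇒bigOr-R₀ R _)) (λ i≤n _ R → num≼num-R₀ R i≤n)

pure-R₀Atom : ∀ {k} {α : Formula k} → PureAtom α → R₀Atom α
pure-R₀Atom (eqv-atom x y)     = ≐-atom _ _
pure-R₀Atom (zeq-atom x)       = ≐-atom _ _
pure-R₀Atom (seq-atom x y)     = ≐-atom _ _
pure-R₀Atom (addeq-atom x y z) = ≐-atom _ _
pure-R₀Atom (muleq-atom x y z) = ≐-atom _ _
pure-R₀Atom (lev-atom x y)     = ≼-atom _ _

cert-bounded : Bounded R₀Atom cert
cert-bounded =
  ∧-bd (atom (≼-atom _ _)) (
  ∧-bd (∀-bd (≼∧-guard (¬-bd (atom (≐-atom _ _)))) (atom (≼-atom _ _))) (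
  ∧-bd (atom A3-atom) (
  ∧-bd (∀-bd (≼∧-guard (¬-bd (atom (≐-atom _ _)))) (atom (A4-atom zero))) (
  ∧-bd (∀-bd ≼-guard (∀-bd ≼-guard (∀-bd ≼-guard (¬-bd (atom (≐-atom _ _)))))) (
  ∧-bd (∀-bd ≼-guard (∀-bd ≼-guard (∀-bd ≼-guard (∀-bd ≼-guard
          (⇒-bd (atom (≐-atom _ _)) (atom (≐-atom _ _))))))) (
  ∧-bd (∀-bd ≼-guard (∀-bd ≼-guard (atom (≐-atom _ _)))) (
  ∧-bd (∀-bd ≼-guard (∀-bd ≼-guard (∀-bd ≼-guard (atom (≐-atom _ _))))) (
  ∧-bd (∀-bd ≼-guard (atom (≐-atom _ _)))
       (∀-bd ≼-guard (∀-bd ≼-guard (atom (≐-atom _ _))))))))))))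

cert-holds : ∀ a → ⟦ cert ⟧ (a ∷ᵉ λ ())
cert-holds a =
  z≤n ,
  (λ x (x≤a , x≢a) → ≤∧≢⇒< x≤a x≢a) ,
  (λ x → n≤0⇒n≡0 , λ { refl → z≤n }) ,
  (λ x _ y → m≤1+n⇒m≤n⊎m≡1+n , m≤n⊎m≡1+n⇒m≤1+n) ,
  (λ x _ y _ z _ ()) ,
  (λ x _ y _ z _ w _ → suc-injective) ,
  (λ x _ y _ → +-identityʳ (x * y)) ,
  (λ x _ y _ z _ → +-suc (x * y) z) ,
  (λ x _ → *-zeroʳ x) ,
  (λ x _ y _ → trans (*-suc x y) (+-comm x (x * y)))

R₀⊢sigCert : (σ₀ : PureΔ₀ 1) → ℕ⊨ sig σ₀ → R₀ ⊢ sigCert σ₀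
R₀⊢sigCert σ₀ (a , σ₀a)
  with R₀-Decision.decide (∧-bd cert-bounded (⌜⌝-bounded pure-R₀Atom σ₀)) (a ∷ᵉ λ ()) (λ _ → tt) R₀-provesR₀
... | inj₁ (_ , proof)      = ∃I (num a) (⊢-cast (fsub-cong (λ { zero → refl }) (cert `∧ ⌜ σ₀ ⌝)) proof)
... | inj₂ (refuted , _)    = ⊥-elim (refuted (cert-holds a , σ₀a))

-- Arithmetic below a certificate

cert-at : ∀ {m} → Term m → Formula m
cert-at V = fsub (λ _ → V) cert

module CertAxioms {m} {Γ : Ctx m} {V : Term m} (c : Γ ⊢ cert-at V) where

  ∀≤V-elim : ∀ {n} (σ : Fin n → Term m) (φ : Formula (suc n)) →
             Γ ⊢ `∀ (var zero ≼ wkT V ⇒ fsub (exts σ) φ) → ∀ t → Γ ⊢ t ≼ V → Γ ⊢ fsub (t ∷ₛ σ) φ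
  ∀≤V-elim σ φ d t = ⇒E (⊢-cast (cong₂ (λ B Φ → t ≼ B ⇒ Φ) (sub0-wkT t V) (sub0-exts t σ φ)) (∀E t d))

  ∀<V-elim : ∀ {n} (σ : Fin n → Term m) (φ : Formula (suc n)) →
             Γ ⊢ `∀ (var zero ≺ wkT V ⇒ fsub (exts σ) φ) → ∀ t → Γ ⊢ t ≺ V → Γ ⊢ fsub (t ∷ₛ σ) φ
  ∀<V-elim σ φ d t = ⇒E (⊢-cast (cong₂ (λ B Φ → t ≺ B ⇒ Φ) (sub0-wkT t V) (sub0-exts t σ φ)) (∀E t d))

  V₀ : Fin 1 → Term m
  V₀ _ = V

  A1 : Γ ⊢ `0 ≼ V
  A1 = ∧E₁ c

  A2 : ∀ {x} → Γ ⊢ x ≺ V → Γ ⊢ `S x ≼ V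
  A2 = ∀<V-elim V₀ (`S (v 0) ≼ v 1) (∧E₁ (∧E₂ c)) _

  A3-at : ∀ x → Γ ⊢ (x ≼ `0) ⇔ (x ≐ `0)
  A3-at = ∀E-exts {σ = V₀} {φ = (v 0 ≼ `0) ⇔ (v 0 ≐ `0)} (∧E₁ (∧E₂ (∧E₂ c)))

  A4-at : ∀ {x} → Γ ⊢ x ≺ V → ∀ y → Γ ⊢ (y ≼ `S x) ⇔ ((y ≼ x) `∨ (y ≐ `S x))
  A4-at {x} x≺V =
    ∀E-exts {σ = x ∷ₛ V₀} {φ = A4-body (v 1)} (∀<V-elim V₀ (A4 (v 0)) (∧E₁ (∧E₂ (∧E₂ (∧E₂ c)))) x x≺V)

  A5 : ∀ {x y z} → Γ ⊢ x ≼ V → Γ ⊢ y ≼ V → Γ ⊢ z ≼ V → Γ ⊢ `¬ (`S ((x `× y) `+ z) ≐ `0)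
  A5 {x} {y} {z} x≼V y≼V z≼V =
    ∀≤V-elim (y ∷ₛ (x ∷ₛ V₀)) body (∀≤V-elim (x ∷ₛ V₀) (∀≤ (v 2) body)
      (∀≤V-elim V₀ (∀≤ (v 1) (∀≤ (v 2) body)) A5-ax x x≼V) y y≼V) z z≼V
    where
    body : Formula 4
    body = `¬ (`S ((v 2 `× v 1) `+ v 0) ≐ `0)
    A5-ax : Γ ⊢ fsub V₀ (∀≤ (v 0) (∀≤ (v 1) (∀≤ (v 2) body)))
    A5-ax = ∧E₁ (∧E₂ (∧E₂ (∧E₂ (∧E₂ c))))

  A6 : ∀ {x y z w} → Γ ⊢ x ≼ V → Γ ⊢ y ≼ V → Γ ⊢ z ≼ V → Γ ⊢ w ≼ V →
       Γ ⊢ `S ((x `× y) `+ z) ≐ `S w ⇒ (x `× y) `+ z ≐ w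
  A6 {x} {y} {z} {w} x≼V y≼V z≼V w≼V =
    ∀≤V-elim (z ∷ₛ (y ∷ₛ (x ∷ₛ V₀))) body (∀≤V-elim (y ∷ₛ (x ∷ₛ V₀)) (∀≤ (v 3) body)
      (∀≤V-elim (x ∷ₛ V₀) (∀≤ (v 2) (∀≤ (v 3) body))
        (∀≤V-elim V₀ (∀≤ (v 1) (∀≤ (v 2) (∀≤ (v 3) body))) A6-ax x x≼V) y y≼V) z z≼V) w w≼V
    where
    body : Formula 5
    body = `S ((v 3 `× v 2) `+ v 1) ≐ `S (v 0) ⇒ (v 3 `× v 2) `+ v 1 ≐ v 0
    A6-ax : Γ ⊢ fsub V₀ (∀≤ (v 0) (∀≤ (v 1) (∀≤ (v 2) (∀≤ (v 3) body))))
    A6-ax = ∧E₁ (∧E₂ (∧E₂ (∧E₂ (∧E₂ (∧E₂ c)))))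

  A7 : ∀ {x y} → Γ ⊢ x ≼ V → Γ ⊢ y ≼ V → Γ ⊢ (x `× y) `+ `0 ≐ x `× y
  A7 {x} {y} x≼V y≼V = ∀≤V-elim (x ∷ₛ V₀) body (∀≤V-elim V₀ (∀≤ (v 1) body) A7-ax x x≼V) y y≼V
    where
    body : Formula 3
    body = (v 1 `× v 0) `+ `0 ≐ v 1 `× v 0
    A7-ax : Γ ⊢ fsub V₀ (∀≤ (v 0) (∀≤ (v 1) body))
    A7-ax = ∧E₁ (∧E₂ (∧E₂ (∧E₂ (∧E₂ (∧E₂ (∧E₂ c))))))

  A8 : ∀ {x y z} → Γ ⊢ x ≼ V → Γ ⊢ y ≼ V → Γ ⊢ z ≼ V → Γ ⊢ (x `× y) `+ `S z ≐ `S ((x `× y) `+ z)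
  A8 {x} {y} {z} x≼V y≼V z≼V =
    ∀≤V-elim (y ∷ₛ (x ∷ₛ V₀)) body (∀≤V-elim (x ∷ₛ V₀) (∀≤ (v 2) body)
      (∀≤V-elim V₀ (∀≤ (v 1) (∀≤ (v 2) body)) A8-ax x x≼V) y y≼V) z z≼V
    where
    body : Formula 4
    body = (v 2 `× v 1) `+ `S (v 0) ≐ `S ((v 2 `× v 1) `+ v 0)
    A8-ax : Γ ⊢ fsub V₀ (∀≤ (v 0) (∀≤ (v 1) (∀≤ (v 2) body)))
    A8-ax = ∧E₁ (∧E₂ (∧E₂ (∧E₂ (∧E₂ (∧E₂ (∧E₂ (∧E₂ c)))))))

  A9 : ∀ {x} → Γ ⊢ x ≼ V → Γ ⊢ x `× `0 ≐ `0
  A9 = ∀≤V-elim V₀ (v 0 `× `0 ≐ `0) (∧E₁ (∧E₂ (∧E₂ (∧E₂ (∧E₂ (∧E₂ (∧E₂ (∧E₂ (∧E₂ c))))))))) _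

  A10 : ∀ {x y} → Γ ⊢ x ≼ V → Γ ⊢ y ≼ V → Γ ⊢ x `× `S y ≐ (x `× y) `+ x
  A10 {x} {y} x≼V y≼V = ∀≤V-elim (x ∷ₛ V₀) body (∀≤V-elim V₀ (∀≤ (v 1) body) A10-ax x x≼V) y y≼V
    where
    body : Formula 3
    body = v 1 `× `S (v 0) ≐ (v 1 `× v 0) `+ v 1
    A10-ax : Γ ⊢ fsub V₀ (∀≤ (v 0) (∀≤ (v 1) body))
    A10-ax = ∧E₂ (∧E₂ (∧E₂ (∧E₂ (∧E₂ (∧E₂ (∧E₂ (∧E₂ (∧E₂ c))))))))

record Certificate {m} (Γ : Ctx m) (V : Term m) (B : ℕ) : Set₁ where
  field
    cert-V : Γ ⊢ cert-at V
    num≺V  : ∀ {k} → k < B → Γ ⊢ num k ≺ V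
open Certificate

certificate-⊆ : ∀ {m} {Γ Δ : Ctx m} {V B} → Γ ⊆ Δ → Certificate Γ V B → Certificate Δ V B
certificate-⊆ Γ⊆Δ C = record { cert-V = ⊢-mono Γ⊆Δ (cert-V C) ; num≺V = ⊢-mono Γ⊆Δ ∘ num≺V C }

certificate-, : ∀ {m} {Γ : Ctx m} {V B φ} → Certificate Γ V B → Certificate (Γ ,, φ) V B
certificate-, = certificate-⊆ ⊆-extend

certificate-↑ : ∀ {m} {Γ : Ctx m} {V B} → Certificate Γ V B → Certificate (↑ Γ) (wkT V) B
certificate-↑ {V = V} C = record
  { cert-V = ⊢-cast (trans (fren-fsub suc (λ _ → V) cert) (fsub-cong {σ' = λ _ → wkT V} (λ _ → refl) cert))
                    (⊢-wk (cert-V C))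
  ; num≺V  = λ {k} k<B → ⊢-cast (cong (λ n → (n ≼ wkT V) `∧ `¬ (n ≐ wkT V)) (tren-num suc k))
                                (⊢-wk (num≺V C k<B))
  }

certificate-suc : ∀ {m} {Γ : Ctx m} {V B} → Certificate Γ V B → Γ ⊢ num B ≺ V → Certificate Γ V (suc B)
certificate-suc {Γ = Γ} {V} {B} C B≺V = record { cert-V = cert-V C ; num≺V = num≺V′ }
  where
  num≺V′ : ∀ {k} → k < suc B → Γ ⊢ num k ≺ V
  num≺V′ k<1+B with m≤n⇒m<n∨m≡n (≤-pred k<1+B)
  ... | inj₁ k<B  = num≺V C k<B
  ... | inj₂ refl = B≺V

-- cert speaks about + only in the form (x × y) + z; since B may be 0, 0 is written as 0 × 0.
num-as-product : ∀ {a B} → a ≤ B → ∃ λ x → ∃ λ y → x ≤ B × y ≤ B × x * y ≡ a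
num-as-product {zero}  _   = 0 , 0 , z≤n , z≤n , refl
num-as-product {suc a} a<B = suc a , 1 , a<B , ≤-trans (s≤s z≤n) a<B , *-identityʳ (suc a)

module _ {m} {Γ : Ctx m} {V : Term m} {B : ℕ} (C : Certificate Γ V B) where
  open CertAxioms (cert-V C)

  num≼V : ∀ {k} → k ≤ B → Γ ⊢ num k ≼ V
  num≼V {zero}  _   = A1
  num≼V {suc k} k<B = A2 (num≺V C k<B)

  num×num     : ∀ {x y} → x ≤ B → y ≤ B → Γ ⊢ num x `× num y ≐ num (x * y)
  num×num+num : ∀ {x y z} → x ≤ B → y ≤ B → z ≤ B → Γ ⊢ (num x `× num y) `+ num z ≐ num (x * y + z)

  num×num {x} {zero}  x≤B _   = ≐num-≡ (sym (*-zeroʳ x)) (A9 (num≼V x≤B))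
  num×num {x} {suc y} x≤B y<B =
    ≐num-≡ (trans (+-comm (x * y) x) (sym (*-suc x y)))
      (≐-trans (A10 (num≼V x≤B) (num≼V (<⇒≤ y<B))) (num×num+num x≤B (<⇒≤ y<B) x≤B))

  num×num+num {x} {y} {zero}  x≤B y≤B _   =
    ≐num-≡ (sym (+-identityʳ (x * y))) (≐-trans (A7 (num≼V x≤B) (num≼V y≤B)) (num×num x≤B y≤B))
  num×num+num {x} {y} {suc z} x≤B y≤B z<B =
    ≐num-≡ (sym (+-suc (x * y) z))
      (≐-trans (A8 (num≼V x≤B) (num≼V y≤B) (num≼V (<⇒≤ z<B))) (≐-S (num×num+num x≤B y≤B (<⇒≤ z<B))))

  S[num×num+num]≉num : ∀ {x y z p} → x ≤ B → y ≤ B → z ≤ B → p ≤ B → suc (x * y + z) ≢ p →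
                       Γ ⊢ `¬ (`S ((num x `× num y) `+ num z) ≐ num p)
  num×num+num≉num    : ∀ {x y z p} → x ≤ B → y ≤ B → z ≤ B → p ≤ B → x * y + z ≢ p →
                       Γ ⊢ `¬ ((num x `× num y) `+ num z ≐ num p)

  S[num×num+num]≉num {p = zero}  x≤B y≤B z≤B _   _ = A5 (num≼V x≤B) (num≼V y≤B) (num≼V z≤B)
  S[num×num+num]≉num {p = suc p} x≤B y≤B z≤B p<B ne =
    contrapositive (A6 (num≼V x≤B) (num≼V y≤B) (num≼V z≤B) (num≼V (<⇒≤ p<B)))
                   (num×num+num≉num x≤B y≤B z≤B (<⇒≤ p<B) (ne ∘ cong suc))

  num×num+num≉num {x} {y} {suc z} x≤B y≤B z<B p≤B ne =
    ≉-resp (A8 (num≼V x≤B) (num≼V y≤B) (num≼V (<⇒≤ z<B))) (≐refl _)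
      (S[num×num+num]≉num x≤B y≤B (<⇒≤ z<B) p≤B (ne ∘ trans (+-suc (x * y) z)))
  num×num+num≉num {x} {zero}  {zero} x≤B y≤B z≤B p≤B ne =
    ≉-resp (≐-trans (A7 (num≼V x≤B) (num≼V y≤B)) (A9 (num≼V x≤B))) (≐refl _)
      (0≉num p≤B (ne ∘ trans (trans (+-identityʳ (x * 0)) (*-zeroʳ x))))
    where
    0≉num : ∀ {p} → p ≤ B → 0 ≢ p → Γ ⊢ `¬ (`0 ≐ num p)
    0≉num {zero}  _   0≢0 = ⊥-elim (0≢0 refl)
    0≉num {suc p} p<B _   =
      ≉-sym (≉-resp (≐-S (≐-sym (num×num+num z≤n z≤n (<⇒≤ p<B)))) (≐refl _)
                    (A5 (num≼V z≤n) (num≼V z≤n) (num≼V (<⇒≤ p<B))))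
  num×num+num≉num {x} {suc y} {zero} x≤B y<B z≤B p≤B ne =
    ≉-resp (≐-trans (A7 (num≼V x≤B) (num≼V y<B)) (A10 (num≼V x≤B) (num≼V (<⇒≤ y<B)))) (≐refl _)
      (num×num+num≉num x≤B (<⇒≤ y<B) x≤B p≤B
        (ne ∘ trans (trans (+-identityʳ (x * suc y)) (trans (*-suc x y) (+-comm x (x * y))))))

  num≼num : ∀ {a b} → a ≤ b → b ≤ B → Γ ⊢ num a ≼ num b
  num≼num {zero} {zero} _ _ = ⇒E (∧E₂ (A3-at `0)) (≐refl `0)
  num≼num {a} {suc b} a≤1+b b<B with m≤1+n⇒m≤n⊎m≡1+n a≤1+b
  ... | inj₂ refl = ⇒E (∧E₂ (A4-at (num≺V C b<B) _)) (∨I₂ (≐refl _))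
  ... | inj₁ a≤b  = ⇒E (∧E₂ (A4-at (num≺V C b<B) _)) (∨I₁ (num≼num a≤b (<⇒≤ b<B)))

  ≼num⇒bigOr : ∀ {t} n → n ≤ B → Γ ⊢ t ≼ num n ⇒ bigOr t n
  ≼num⇒bigOr {t} zero    _   = ∧E₁ (A3-at t)
  ≼num⇒bigOr {t} (suc n) n<B =
    ⇒I (∨E (⇒E (⊢-weaken (∧E₁ (A4-at (num≺V C n<B) t))) assume)
           (∨I₁ (⇒E (⊢-weaken (⊢-weaken (≼num⇒bigOr n (<⇒≤ n<B)))) assume))
           (∨I₂ assume))

  num≉num : ∀ {a b} → a ≤ B → b ≤ B → a ≢ b → Γ ⊢ `¬ (num a ≐ num b)
  num≉num a≤B b≤B ne =
    ≉-resp (≐-sym (num×num+num z≤n z≤n a≤B)) (≐refl _) (num×num+num≉num z≤n z≤n a≤B b≤B ne)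

  S[num]≉num : ∀ {a b} → a ≤ B → b ≤ B → suc a ≢ b → Γ ⊢ `¬ (`S (num a) ≐ num b)
  S[num]≉num a≤B b≤B ne =
    ≉-resp (≐-S (≐-sym (num×num+num z≤n z≤n a≤B))) (≐refl _) (S[num×num+num]≉num z≤n z≤n a≤B b≤B ne)

  num×num≉num : ∀ {x y p} → x ≤ B → y ≤ B → p ≤ B → x * y ≢ p → Γ ⊢ `¬ (num x `× num y ≐ num p)
  num×num≉num {x} {y} x≤B y≤B p≤B ne =
    ≉-resp (≐-sym (A7 (num≼V x≤B) (num≼V y≤B))) (≐refl _)
      (num×num+num≉num x≤B y≤B z≤n p≤B (ne ∘ trans (sym (+-identityʳ (x * y)))))

  num⋠num : ∀ {a b} → a ≤ B → b ≤ B → ¬ a ≤ b → Γ ⊢ `¬ (num a ≼ num b)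
  num⋠num {b = b} a≤B b≤B a≰b =
    contrapositive (≼num⇒bigOr b b≤B)
      (bigOr-refute b λ j j≤b → num≉num a≤B (≤-trans j≤b b≤B) λ { refl → a≰b j≤b })

  num+num : ∀ {a b} → a ≤ B → b ≤ B → Γ ⊢ num a `+ num b ≐ num (a + b)
  num+num a≤B b≤B with num-as-product a≤B
  ... | x , y , x≤B , y≤B , refl =
    ≐-trans (≐-+ (≐-sym (num×num x≤B y≤B)) (≐refl _)) (num×num+num x≤B y≤B b≤B)

  num+num≉num : ∀ {a b p} → a ≤ B → b ≤ B → p ≤ B → a + b ≢ p → Γ ⊢ `¬ (num a `+ num b ≐ num p)
  num+num≉num a≤B b≤B p≤B ne with num-as-product a≤B
  ... | x , y , x≤B , y≤B , refl =
    ≉-resp (≐-+ (≐-sym (num×num x≤B y≤B)) (≐refl _)) (≐refl _) (num×num+num≉num x≤B y≤B b≤B p≤B ne)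

decide-PureAtom : ∀ {B k m} {Γ : Ctx m} {α : Formula k} → PureAtom α → (ρ : Fin k → ℕ) →
                  (∀ j → ρ j ≤ B) → (∃ λ V → Certificate Γ V B) → Decides Γ α ρ
decide-PureAtom (eqv-atom x y) ρ r (_ , C) with ρ x ≟ ρ y
... | yes e = inj₁ (e , ≐num-≡ e (≐refl _))
... | no ne    = inj₂ (ne , num≉num C (r x) (r y) ne)
decide-PureAtom (zeq-atom x) ρ r (_ , C) with 0 ≟ ρ x
... | yes e = inj₁ (e , ≐num-≡ e (≐refl _))
... | no ne = inj₂ (ne , num≉num C z≤n (r x) ne)
decide-PureAtom (seq-atom x y) ρ r (_ , C) with suc (ρ x) ≟ ρ y
... | yes e = inj₁ (e , ≐num-≡ e (≐refl _))
... | no ne = inj₂ (ne , S[num]≉num C (r x) (r y) ne)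
decide-PureAtom (addeq-atom x y z) ρ r (_ , C) with ρ x + ρ y ≟ ρ z
... | yes e = inj₁ (e , ≐num-≡ e (num+num C (r x) (r y)))
... | no ne = inj₂ (ne , num+num≉num C (r x) (r y) (r z) ne)
decide-PureAtom (muleq-atom x y z) ρ r (_ , C) with ρ x * ρ y ≟ ρ z
... | yes e = inj₁ (e , ≐num-≡ e (num×num C (r x) (r y)))
... | no ne = inj₂ (ne , num×num≉num C (r x) (r y) (r z) ne)
decide-PureAtom (lev-atom x y) ρ r (_ , C) with ρ x ≤? ρ y
... | yes x≤y = inj₁ (x≤y , num≼num C x≤y (r y))
... | no x≰y  = inj₂ (x≰y , num⋠num C (r x) (r y) x≰y)

module CertificateDecision (B : ℕ) = Decision PureAtom (λ Γ → ∃ λ V → Certificate Γ V B) (_≤ B) ≤-trans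
  (λ Γ⊆Δ (V , C) → V , certificate-⊆ Γ⊆Δ C) (λ (V , C) → wkT V , certificate-↑ C) decide-PureAtom
  (λ n≤B (_ , C) → ⇒E (≼num⇒bigOr C _ n≤B)) (λ i≤n n≤B (_ , C) → num≼num C i≤n n≤B)

certificate-cases : ∀ {m} {Γ : Ctx m} {V G} K → Certificate Γ V 0 →
  (∀ {Δ} → Γ ⊆ Δ → Certificate Δ V K → Δ ⊢ G) →
  (∀ {Δ} → Γ ⊆ Δ → ∀ i → Certificate Δ V i → Δ ⊢ V ≐ num i → Δ ⊢ G) → Γ ⊢ G
certificate-cases zero    C above equal = above ⊆-refl C
certificate-cases {Γ = Γ} {V} {G} (suc K) C above equal = certificate-cases K C step equal
  where
  step : ∀ {Δ} → Γ ⊆ Δ → Certificate Δ V K → Δ ⊢ G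
  step Γ⊆Δ CK = by-cases (num K ≐ V)
    (equal (⊆-trans Γ⊆Δ ⊆-extend) K (certificate-, CK) (≐-sym assume))
    (above (⊆-trans Γ⊆Δ ⊆-extend)
           (certificate-suc (certificate-, CK) (∧I (num≼V (certificate-, CK) ≤-refl) assume)))

-- Only the arguments of an axiom have to lie below V, not its value.
axiom-bound : R₀Axiom → ℕ
axiom-bound (plus a b)      = a + b
axiom-bound (times a b)     = a + b
axiom-bound (apart a b _)   = a + b
axiom-bound (bounded b)     = b
axiom-bound (ordered a b _) = a + b

certificate-proves-axiom : ∀ {m} {Γ : Ctx m} {V} ax → Certificate Γ V (axiom-bound ax) → Γ ⊢ axiom ax
certificate-proves-axiom (plus a b)        C = num+num C (m≤m+n a b) (m≤n+m b a)
certificate-proves-axiom (times a b)       C = num×num C (m≤m+n a b) (m≤n+m b a)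
certificate-proves-axiom (apart a b a≢b)   C = num≉num C (m≤m+n a b) (m≤n+m b a) a≢b
certificate-proves-axiom (bounded b)       C = ∀I (≼num⇒bigOr (certificate-↑ C) b ≤-refl)
certificate-proves-axiom (ordered a b a≤b) C = num≼num C a≤b (m≤n+m b a)

certified-counterexample⇒provesR₀ :
  ∀ (σ₀ : PureΔ₀ 1) → (∀ a → ¬ ⟦ ⌜ σ₀ ⌝ ⟧ (a ∷ᵉ λ ())) →
  ∀ {m} {Γ : Ctx m} {V} → Γ ⊢ cert-at V → Γ ⊢ fsub (λ _ → V) ⌜ σ₀ ⌝ → ProvesR₀ Γ
certified-counterexample⇒provesR₀ σ₀ false {m} {Γ} {V} c σ₀V ax =
  certificate-cases (axiom-bound ax) (record { cert-V = c ; num≺V = λ () })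
    (λ _ → certificate-proves-axiom ax) V-is-numeral
  where
  Φ : Formula (suc m)
  Φ = fsub (λ _ → var zero) ⌜ σ₀ ⌝
  Φ-at : ∀ {σ : Fin 1 → Term m} → Φ [ σ zero ] ≡ fsub σ ⌜ σ₀ ⌝
  Φ-at = trans (fsub-∘ _ _ ⌜ σ₀ ⌝) (fsub-cong (λ { zero → refl }) ⌜ σ₀ ⌝)
  V-is-numeral : ∀ {Δ} → Γ ⊆ Δ → ∀ i → Certificate Δ V i → Δ ⊢ V ≐ num i → Δ ⊢ axiom ax
  V-is-numeral Γ⊆Δ i C V≐i
    with CertificateDecision.decide i (⌜⌝-bounded (λ α → α) σ₀) (i ∷ᵉ λ ()) (λ { zero → ≤-refl }) (V , C)
  ... | inj₁ (σ₀i , _)        = ⊥-elim (false i σ₀i)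
  ... | inj₂ (_ , refutation) =
    ⊥E (¬E refutation (≐-transport Φ Φ-at Φ-at V≐i (⊢-mono Γ⊆Δ σ₀V)))

sigCert⊢R₀ : (σ₀ : PureΔ₀ 1) → ℕ⊨ (`¬ sig σ₀) → ⟨ sigCert σ₀ ⟩ ⊢ᵀ R₀
sigCert⊢R₀ σ₀ ¬σ φ φ∈R₀ with R₀-axiom φ∈R₀
... | ax , refl = ∃E (hyp refl) (⊢-cast (sym (fren-axiom suc ax))
        (certified-counterexample⇒provesR₀ σ₀ (λ a σ₀a → ¬σ (a , σ₀a))
           (⊢-cast (sym (fsub-var₀ cert)) (∧E₁ assume))
           (⊢-cast (sym (fsub-var₀ ⌜ σ₀ ⌝)) (∧E₂ assume)) ax))

theorem4p5 : (σ₀ : PureΔ₀ 1) →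
    (⟨ sigCert σ₀ ⟩ ⊢ sig σ₀)
    × ((ℕ⊨ sig σ₀) → R₀ ⊢ sigCert σ₀)
    × ((ℕ⊨ (`¬ sig σ₀)) → ⟨ sigCert σ₀ ⟩ ⊢ᵀ R₀)
theorem4p5 σ₀ = ∃-∧E₂ (hyp refl) , R₀⊢sigCert σ₀ , sigCert⊢R₀ σ₀
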